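{- Let $p\ge5$, $\chi:\mathcal{O}_D^\times\to\mathbb{F}^\times$ a smooth character viewed by restriction as a character of $U_D^2H$, and $0\ne v\in\chi$. For $0\le k\le q-1$ let $f_{k,v}=\sum_{\lambda\in\mathbb{F}_q}\lambda^k[1+\varpi_D[\lambda],v]\in\mathrm{Ind}_{U_D^2H}^{\mathcal{O}_D^\times}\chi$. Then for each $k$ the subrepresentation of $\mathrm{Ind}_{U_D^2H}^{\mathcal{O}_D^\times}\chi$ generated by $f_{k,v}$ is spanned over $\mathbb{F}$ by $\{f_{k',v}:k'\preceq k\}$. In particular, the $\mathcal{O}_D^\times$-socle of $\mathrm{Ind}_{U_D^2H}^{\mathcal{O}_D^\times}\chi$ is one-dimensional, spanned by $f_{0,v}$.
   Context: $q=p^2$; $D$ non-split quaternion algebra over $\mathbb{Q}_p$, $\mathcal{O}_D$ maximal order, $\varpi_D$ uniformizer with $\varpi_D^2=p$, $U_D^n=1+\varpi_D^n\mathcal{O}_D$; $[\cdot]:\mathbb{F}_q\to\mathbb{Z}_q\subset\mathcal{O}_D$ Teichmüller lift; $H$ the image of $\mathbb{F}_q^\times$; $\mathbb{F}$ finite of characteristic $p$ with fixed $\mathbb{F}_q\hookrightarrow\mathbb{F}$, used to view $\lambda^k\in\mathbb{F}$ (with $0^0=1$). For $g\in\mathcal{O}_D^\times$, $[g,v]$ denotes the unique function in $\mathrm{Ind}_{U_D^2H}^{\mathcal{O}_D^\times}\chi$ supported on $(U_D^2H)g^{ -1}$ with $[g,v](g^{ -1})=v$. For $0\le k,k'\le q-1$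 with $p$-adic expansions $k=k_0+pk_1$, $k'=k'_0+pk'_1$ ($0\le k_i,k'_i\le p-1$), $k'\preceq k$ means $k'_0\le k_0$ and $k'_1\le k_1$. -}

module Defs where

open import Level using (0ℓ)
open import Data.Nat as ℕ using (ℕ; zero; suc; _<_; _≤_)
open import Data.Product using (Σ; _×_; _,_; proj₁; proj₂)
open import Data.List using (List; []; _∷_; map)
open import Data.List.Relation.Unary.All using (All)
open import Relation.Binary.PropositionalEquality using (_≡_)
open import Relation.Binary.Definitions using (DecidableEquality)
open import Relation.Nullary using (¬_; yes; no)
open import Algebra.Structures using (IsCommutativeRing)

record Field : Set₁ where
  infixl 6 _+_
  infixl 7 _*_
  field
    Carrier : Set
    _+_ _*_ : Carrier → Carrier → Carrier
    -_ : Carrier → Carrier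
    0# 1# : Carrier
    isCommutativeRing : IsCommutativeRing _≡_ _+_ _*_ -_ 0# 1#
    _⁻¹ : Carrier → Carrier
    ⁻¹-inverse : ∀ x → ¬ x ≡ 0# → x * (x ⁻¹) ≡ 1#
    0≢1 : ¬ 0# ≡ 1#
    _≟_ : DecidableEquality Carrier

Digits : ℕ → ℕ → ℕ → ℕ → Set
Digits p k k₀ k₁ = k₀ < p × k₁ < p × k ≡ k₀ ℕ.+ p ℕ.* k₁

Preceq : ℕ → ℕ → ℕ → Set
Preceq p k' k =
  Σ ℕ λ k₀ → Σ ℕ λ k₁ → Σ ℕ λ k₀' → Σ ℕ λ k₁' →
    Digits p k k₀ k₁ × Digits p k' k₀' k₁' × k₀' ≤ k₀ × k₁' ≤ k₁

module Rep (F : Field) (p : ℕ) where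
  open Field F public

  infixr 8 _^_
  _^_ : Carrier → ℕ → Carrier
  x ^ zero  = 1#
  x ^ suc n = x * (x ^ n)

  q : ℕ
  q = p ℕ.* p

  natF : ℕ → Carrier
  natF zero    = 0#
  natF (suc n) = 1# + natF n

  sumF : List Carrier → Carrier
  sumF []       = 0#
  sumF (x ∷ xs) = x + sumF xs

  sumBelow : ℕ → (ℕ → Carrier) → Carrier
  sumBelow zero    f = 0#
  sumBelow (suc n) f = sumBelow n f + f n

  -- F_q inside F : the roots of X^q - X
  InFq : Carrier → Set
  InFq x = x ^ q ≡ x

  -- O_D / ϖ_D² O_D = F_q ⊕ ϖ_D F_q : the pair (a , b) stands for a + ϖ_D b,
  -- with ϖ_D² = 0 and x ϖ_D = ϖ_D x^p (Frobenius twist); thus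
  -- (a + ϖ b)(a' + ϖ b') = a a' + ϖ (a^p b' + b a').
  Pt : Set
  Pt = Carrier × Carrier

  mul : Pt → Pt → Pt
  mul (a , b) (a' , b') = (a * a' , (a ^ p) * b' + b * a')

  -- G = O_D^× / U_D² : units, i.e. a ≠ 0
  InG : Pt → Set
  InG (a , b) = InFq a × ¬ a ≡ 0# × InFq b

  -- image of U_D² H in G : Teichmüller lifts [a], a ∈ F_q^×
  InH : Pt → Set
  InH (a , b) = InFq a × ¬ a ≡ 0# × b ≡ 0#

  IsCharacter : (Pt → Carrier) → Set
  IsCharacter χ =
    (∀ g → InG g → ¬ χ g ≡ 0#) ×
    (∀ g h → InG g → InG h → χ (mul g h) ≡ χ g * χ h)

  -- functions on G (represented on all of Pt; only values on G matter)
  Fun : Set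
  Fun = Pt → Carrier

  _≈G_ : Fun → Fun → Set
  f ≈G f' = ∀ x → InG x → f x ≡ f' x

  zeroF : Fun
  zeroF x = 0#

  addF : Fun → Fun → Fun
  addF f f' x = f x + f' x

  scaleF : Carrier → Fun → Fun
  scaleF c f x = c * f x

  act : Pt → Fun → Fun
  act g f x = f (mul x g)

  -- f ∈ Ind_{U_D² H}^{O_D^×} χ  (χ one-dimensional, v ∈ χ identified with F)
  IsInd : (Pt → Carrier) → Fun → Set
  IsInd χ f = ∀ h x → InH h → InG x → f (mul h x) ≡ χ h * f x

  -- [g , v] : supported on H g⁻¹, value v at g⁻¹; explicitly
  -- [g , v](x) = χ(x g) v if x g ∈ H, and 0 otherwise (for x ∈ G).
  bracket : (Pt → Carrier) → Pt → Carrier → Fun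
  bracket χ g v x with proj₂ (mul x g) ≟ 0#
  ... | yes _ = χ (mul x g) * v
  ... | no  _ = 0#

  fkv : List Carrier → (Pt → Carrier) → ℕ → Carrier → Fun
  fkv Fq χ k v x = sumF (map (λ l → (l ^ k) * bracket χ (1# , l) v x) Fq)

  record IsSubrep (χ : Pt → Carrier) (W : Fun → Set) : Set where
    field
      ⊆Ind   : ∀ f → W f → IsInd χ f
      resp   : ∀ f f' → f ≈G f' → W f → W f'
      zero∈  : W zeroF
      add∈   : ∀ f f' → W f → W f' → W (addF f f')
      scale∈ : ∀ c f → W f → W (scaleF c f)
      act∈   : ∀ g f → InG g → W f → W (act g f)

  NonZeroF : Fun → Set
  NonZeroF f = Σ Pt λ x → InG x × ¬ f x ≡ 0#

  Generated : (Pt → Carrier) → Fun → Fun → Set₁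
  Generated χ f h = ∀ (W : Fun → Set) → IsSubrep χ W → W f → W h

  SpanPrec : List Carrier → (Pt → Carrier) → Carrier → ℕ → Fun → Set
  SpanPrec Fq χ v k h =
    Σ (ℕ → Carrier) λ c →
      (∀ k' → ¬ Preceq p k' k → c k' ≡ 0#) ×
      (h ≈G (λ x → sumBelow q (λ k' → c k' * fkv Fq χ k' v x)))

  SpanOne : Fun → Fun → Set
  SpanOne f h = Σ Carrier λ c → h ≈G scaleF c f

  IsIrreducible : (Pt → Carrier) → (Fun → Set) → Set₁
  IsIrreducible χ W =
    IsSubrep χ W ×
    (Σ Fun λ f → W f × NonZeroF f) ×
    (∀ (W' : Fun → Set) → IsSubrep χ W' → (∀ f → W' f → W f) →
       (Σ Fun λ f → W' f × NonZeroF f) → ∀ f → W f → W' f)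

  sumFuns : List Fun → Fun
  sumFuns []       = zeroF
  sumFuns (f ∷ fs) = addF f (sumFuns fs)

  InSocle : (Pt → Carrier) → Fun → Set₁
  InSocle χ h =
    Σ (List Fun) λ gs →
      All (λ g → Σ (Fun → Set) λ W → IsIrreducible χ W × W g) gs ×
      (h ≈G sumFuns gs)

-- Write x = a + ϖ b ∈ G = O_D^× / U_D² and u x = -b / a^p; then f_{k,v} = u^k ψ with ψ x = χ(a) v, and
-- interpolation on F_q shows that every f ∈ Ind χ is a combination Σ_{j<q} c_j f_{j,v}. Right translation
-- by g ∈ G acts affinely on u, so by Lucas' theorem it maps f_{k,v} into the span of the f_{j,v} with
-- j ⪯ k: that span is a subrepresentation. Conversely, translating Σ_j c_j f_{j,v} by 1 + ϖ[-t] gives a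
-- polynomial in t of degree < q whose m-th coefficient is Σ_j c_j (j choose m) f_{j-m,v}; since it takes
-- values in a subrepresentation W at all q points t ∈ F_q, a Vandermonde argument puts every coefficient
-- in W. For c = δ_k this yields each f_{j,v} with j ⪯ k, as (k choose k-j) ≢ 0 mod p; for the largest J
-- with c_J ≠ 0 it yields c_J f_{0,v}. Hence f_{0,v} lies in every nonzero subrepresentation, and its line
-- is the socle.

module Submission where

open import Defs
open import Algebra.Bundles using (CommutativeRing)
open import Data.Empty using (⊥-elim)
open import Data.Fin.Base using (toℕ)
open import Data.Integer.Base as ℤ using (ℤ; -[1+_]; _⊖_; 0ℤ; 1ℤ)
import Data.Integer.Properties as ℤ
open import Data.List using (List; []; _∷_; length; map; applyUpTo)
open import Data.List.Membership.Propositional using (_∈_)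
open import Data.List.Properties using (length-applyUpTo; map-cong)
open import Data.List.Relation.Unary.All as All using (All; []; _∷_)
open import Data.List.Relation.Unary.All.Properties using (applyUpTo⁻)
open import Data.List.Relation.Unary.AllPairs using (_∷_)
open import Data.List.Relation.Unary.Any using (here; there)
open import Data.List.Relation.Unary.Unique.Propositional using (Unique)
open import Data.Maybe.Base using (Maybe; just; nothing)
open import Data.Nat using (ℕ; _≤_; _<_)
open import Data.Nat.Base as ℕ using (zero; suc; _∸_; _!; z≤n; s≤s; NonZero)
open import Data.Nat.Combinatorics using (_C_; nCn≡1; k>n⇒nCk≡0; nCk≡n!/k![n-k]!; k![n∸k]!∣n!)
open import Data.Nat.Coprimality using (prime⇒coprime; coprime-Bézout)
open import Data.Nat.DivMod
  using (_%_; _/_; m≡m%n+[m/n]*n; m%n<n; [m+kn]%n≡m%n; m<n⇒m%n≡m; +-distrib-/-∣ʳ; m<n⇒m/n≡0; m*n/n≡m; m/n*n≡m; m<n*o⇒m/o<n)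
open import Data.Nat.Divisibility using (_∣_; _∤_; divides; ∣⇒≤; m∣m*n; ∣m⇒∣m*n; m%n≡0⇒n∣m)
open import Data.Nat.GCD using (module Bézout)
open import Data.Nat.Primality using (Prime; euclidsLemma; prime⇒nonZero; prime⇒nonTrivial)
import Data.Nat.Properties as ℕ
open import Data.Nat.Tactic.RingSolver using (solve-∀)
open import Data.Product using (Σ; _×_; _,_; proj₁; proj₂)
open import Data.Sum using (_⊎_; inj₁; inj₂; [_,_]′)
open import Function using (_∘_; flip)
open import Level using (0ℓ)
open import Relation.Binary.Definitions using (tri<; tri≈; tri>)
open import Relation.Binary.PropositionalEquality as ≡
  using (_≡_; _≢_; refl; sym; trans; cong; cong₂; subst; subst₂; module ≡-Reasoning)
open import Relation.Nullary using (¬_; yes; no)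
open import Relation.Nullary.Decidable using (Dec; _×-dec_)

-- The optimised multiplication _×′_ makes ⟦ 0ℤ ⟧ and ⟦ 1ℤ ⟧ reduce to 0# and 1#, so that con 0ℤ and con 1ℤ
-- can stand for 0# and 1# in solver goals.
module IntegerCoefficients {c ℓ} (R : CommutativeRing c ℓ) where

  open CommutativeRing R renaming (refl to ≈-refl; sym to ≈-sym; trans to ≈-trans; reflexive to ≈-reflexive)
  open import Algebra.Properties.CommutativeSemigroup +-commutativeSemigroup using (interchange)
  open import Algebra.Properties.Ring ring using (-0#≈0#; -‿involutive; -‿+-comm; -‿distribˡ-*; -‿distribʳ-*)
  open import Algebra.Properties.Semiring.Mult.TCOptimised semiring
    using (×-homo-+; ×1-homo-*; 1+×) renaming (_×_ to _×′_)
  open import Algebra.Solver.Ring.AlmostCommutativeRing using (fromCommutativeRing; _-Raw-AlmostCommutative⟶_)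
  import Algebra.Solver.Ring as Solver
  open import Relation.Binary.Reasoning.Setoid setoid

  ⟦_⟧ : ℤ → Carrier
  ⟦ ℤ.+ n ⟧    = n ×′ 1#
  ⟦ -[1+ n ] ⟧ = - (suc n ×′ 1#)

  ⟦⊖⟧ : ∀ m n → ⟦ m ⊖ n ⟧ ≈ m ×′ 1# - n ×′ 1#
  ⟦⊖⟧ zero    zero    = ≈-sym (≈-trans (+-identityˡ _) -0#≈0#)
  ⟦⊖⟧ (suc m) zero    = ≈-sym (≈-trans (+-congˡ -0#≈0#) (+-identityʳ _))
  ⟦⊖⟧ zero    (suc n) = ≈-sym (+-identityˡ _)
  ⟦⊖⟧ (suc m) (suc n) = begin
    ⟦ suc m ⊖ suc n ⟧                  ≡⟨ cong ⟦_⟧ (ℤ.[1+m]⊖[1+n]≡m⊖n m n) ⟩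
    ⟦ m ⊖ n ⟧                          ≈⟨ ⟦⊖⟧ m n ⟩
    m ×′ 1# - n ×′ 1#                  ≈⟨ +-identityˡ _ ⟨
    0# + (m ×′ 1# - n ×′ 1#)           ≈⟨ +-congʳ (-‿inverseʳ 1#) ⟨
    (1# - 1#) + (m ×′ 1# - n ×′ 1#)    ≈⟨ interchange 1# (- 1#) (m ×′ 1#) (- (n ×′ 1#)) ⟩
    (1# + m ×′ 1#) + (- 1# - n ×′ 1#)  ≈⟨ +-cong (1+× m 1#) (≈-trans (-‿cong (1+× n 1#)) (≈-sym (-‿+-comm 1# _))) ⟨
    suc m ×′ 1# - suc n ×′ 1#          ∎

  ⟦-⟧ : ∀ i → ⟦ ℤ.- i ⟧ ≈ - ⟦ i ⟧
  ⟦-⟧ (ℤ.+ zero)  = ≈-sym -0#≈0#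
  ⟦-⟧ (ℤ.+ suc n) = ≈-refl
  ⟦-⟧ -[1+ n ]    = ≈-sym (-‿involutive _)

  ⟦+⟧ : ∀ i j → ⟦ i ℤ.+ j ⟧ ≈ ⟦ i ⟧ + ⟦ j ⟧
  ⟦+⟧ (ℤ.+ m)  (ℤ.+ n)  = ×-homo-+ 1# m n
  ⟦+⟧ (ℤ.+ m)  -[1+ n ] = ⟦⊖⟧ m (suc n)
  ⟦+⟧ -[1+ m ] (ℤ.+ n)  = ≈-trans (⟦⊖⟧ n (suc m)) (+-comm _ _)
  ⟦+⟧ -[1+ m ] -[1+ n ] = begin
    - (suc (suc (m ℕ.+ n)) ×′ 1#)      ≡⟨ cong (λ k → - (suc k ×′ 1#)) (ℕ.+-suc m n) ⟨
    - ((suc m ℕ.+ suc n) ×′ 1#)        ≈⟨ -‿cong (×-homo-+ 1# (suc m) (suc n)) ⟩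
    - (suc m ×′ 1# + suc n ×′ 1#)      ≈⟨ -‿+-comm _ _ ⟨
    - (suc m ×′ 1#) + - (suc n ×′ 1#)  ∎

  ⟦*⟧-pos : ∀ m n → ⟦ ℤ.+ m ℤ.* ℤ.+ n ⟧ ≈ ⟦ ℤ.+ m ⟧ * ⟦ ℤ.+ n ⟧
  ⟦*⟧-pos m n = ≈-trans (≈-reflexive (cong ⟦_⟧ (≡.sym (ℤ.pos-* m n)))) (×1-homo-* m n)

  ⟦*⟧ : ∀ i j → ⟦ i ℤ.* j ⟧ ≈ ⟦ i ⟧ * ⟦ j ⟧
  ⟦*⟧ (ℤ.+ m)  (ℤ.+ n)  = ⟦*⟧-pos m n
  ⟦*⟧ (ℤ.+ m)  -[1+ n ] = begin
    ⟦ ℤ.+ m ℤ.* ℤ.- ℤ.+ suc n ⟧        ≡⟨ cong ⟦_⟧ (ℤ.neg-distribʳ-* (ℤ.+ m) (ℤ.+ suc n)) ⟨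
    ⟦ ℤ.- (ℤ.+ m ℤ.* ℤ.+ suc n) ⟧      ≈⟨ ⟦-⟧ (ℤ.+ m ℤ.* ℤ.+ suc n) ⟩
    - ⟦ ℤ.+ m ℤ.* ℤ.+ suc n ⟧          ≈⟨ -‿cong (⟦*⟧-pos m (suc n)) ⟩
    - (⟦ ℤ.+ m ⟧ * ⟦ ℤ.+ suc n ⟧)      ≈⟨ -‿distribʳ-* _ _ ⟩
    ⟦ ℤ.+ m ⟧ * ⟦ -[1+ n ] ⟧           ∎
  ⟦*⟧ -[1+ m ] (ℤ.+ n)  = begin
    ⟦ ℤ.- ℤ.+ suc m ℤ.* ℤ.+ n ⟧        ≡⟨ cong ⟦_⟧ (ℤ.neg-distribˡ-* (ℤ.+ suc m) (ℤ.+ n)) ⟨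
    ⟦ ℤ.- (ℤ.+ suc m ℤ.* ℤ.+ n) ⟧      ≈⟨ ⟦-⟧ (ℤ.+ suc m ℤ.* ℤ.+ n) ⟩
    - ⟦ ℤ.+ suc m ℤ.* ℤ.+ n ⟧          ≈⟨ -‿cong (⟦*⟧-pos (suc m) n) ⟩
    - (⟦ ℤ.+ suc m ⟧ * ⟦ ℤ.+ n ⟧)      ≈⟨ -‿distribˡ-* _ _ ⟩
    ⟦ -[1+ m ] ⟧ * ⟦ ℤ.+ n ⟧           ∎
  ⟦*⟧ -[1+ m ] -[1+ n ] = begin
    ⟦ ℤ.+ suc m ℤ.* ℤ.+ suc n ⟧          ≈⟨ ⟦*⟧-pos (suc m) (suc n) ⟩
    ⟦ ℤ.+ suc m ⟧ * ⟦ ℤ.+ suc n ⟧        ≈⟨ -‿involutive _ ⟨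
    - - (⟦ ℤ.+ suc m ⟧ * ⟦ ℤ.+ suc n ⟧)  ≈⟨ -‿cong (-‿distribˡ-* _ _) ⟩
    - (⟦ -[1+ m ] ⟧ * ⟦ ℤ.+ suc n ⟧)     ≈⟨ -‿distribʳ-* _ _ ⟩
    ⟦ -[1+ m ] ⟧ * ⟦ -[1+ n ] ⟧          ∎

  ℤ-cast : CommutativeRing.rawRing ℤ.+-*-commutativeRing -Raw-AlmostCommutative⟶ fromCommutativeRing R
  ℤ-cast = record
    { ⟦_⟧ = ⟦_⟧ ; +-homo = ⟦+⟧ ; *-homo = ⟦*⟧ ; -‿homo = ⟦-⟧ ; 0-homo = ≈-refl ; 1-homo = ≈-refl }

  ⟦⟧-weaklyDec : ∀ i j → Maybe (⟦ i ⟧ ≈ ⟦ j ⟧)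
  ⟦⟧-weaklyDec i j with i ℤ.≟ j
  ... | yes i≡j = just (≈-reflexive (cong ⟦_⟧ i≡j))
  ... | no  _   = nothing

  open Solver (CommutativeRing.rawRing ℤ.+-*-commutativeRing) (fromCommutativeRing R) ℤ-cast ⟦⟧-weaklyDec public
    using (solve; _:+_; _:*_; :-_; _:-_; _:=_; con)

module FieldLemmas (F : Field) (p : ℕ) where

  open Rep F p public

  commutativeRing : CommutativeRing 0ℓ 0ℓ
  commutativeRing = record { isCommutativeRing = isCommutativeRing }

  open CommutativeRing commutativeRing public
    using ( +-assoc; +-comm; +-identityˡ; +-identityʳ; -‿inverseʳ
          ; *-assoc; *-comm; *-identityˡ; *-identityʳ; distribˡ; distribʳ; zeroˡ; zeroʳ)
  open import Algebra.Properties.Ring (CommutativeRing.ring commutativeRing) public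
    using (-0#≈0#; +-cancelʳ; -‿involutive; -‿injective; -1*x≈-x; +-inverseʳ-unique)
  open IntegerCoefficients commutativeRing public using (solve; _:+_; _:*_; :-_; _:-_; _:=_; con)
  open import Algebra.Properties.CommutativeSemigroup (CommutativeRing.+-commutativeSemigroup commutativeRing) public
    using () renaming (interchange to +-interchange)
  open import Algebra.Properties.CommutativeSemigroup (CommutativeRing.*-commutativeSemigroup commutativeRing) public
    using (x∙yz≈y∙xz; xy∙z≈y∙xz) renaming (interchange to *-interchange)
  open import Algebra.Properties.Semiring.Mult (CommutativeRing.semiring commutativeRing)
    using (×-homo-+; ×1-homo-*; ×-assoc-*) renaming (_×_ to _×ᵤ_)
  open import Algebra.Properties.Semiring.Sum (CommutativeRing.semiring commutativeRing) using (sum-syntax)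
  open import Algebra.Properties.Semiring.Exp (CommutativeRing.semiring commutativeRing) using () renaming (_^_ to _^ₛ_)
  import Algebra.Properties.CommutativeSemiring.Binomial (CommutativeRing.commutativeSemiring commutativeRing) as Binomial
  open ≡-Reasoning

  1≢0 : 1# ≢ 0#
  1≢0 = 0≢1 ∘ sym

  ⁻¹-inverseˡ : ∀ {x} → x ≢ 0# → x ⁻¹ * x ≡ 1#
  ⁻¹-inverseˡ {x} x≢0 = trans (*-comm _ _) (⁻¹-inverse x x≢0)

  ⁻¹-cancelˡ : ∀ {x} y → x ≢ 0# → x ⁻¹ * (x * y) ≡ y
  ⁻¹-cancelˡ {x} y x≢0 = trans (sym (*-assoc _ _ _)) (trans (cong (_* y) (⁻¹-inverseˡ x≢0)) (*-identityˡ y))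

  *-cancelˡ : ∀ {x} y z → x ≢ 0# → x * y ≡ x * z → y ≡ z
  *-cancelˡ {x} y z x≢0 xy≡xz = trans (sym (⁻¹-cancelˡ y x≢0)) (trans (cong (x ⁻¹ *_) xy≡xz) (⁻¹-cancelˡ z x≢0))

  *≢0 : ∀ {x y} → x ≢ 0# → y ≢ 0# → x * y ≢ 0#
  *≢0 {x} {y} x≢0 y≢0 xy≡0 = y≢0 (*-cancelˡ y 0# x≢0 (trans xy≡0 (sym (zeroʳ x))))

  ^≢0 : ∀ {x} n → x ≢ 0# → x ^ n ≢ 0#
  ^≢0 zero    x≢0 = 1≢0
  ^≢0 (suc n) x≢0 = *≢0 x≢0 (^≢0 n x≢0)

  ⁻¹-unique : ∀ {x y} → x * y ≡ 1# → y ≡ x ⁻¹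
  ⁻¹-unique {x} {y} xy≡1 = *-cancelˡ y (x ⁻¹) x≢0 (trans xy≡1 (sym (⁻¹-inverse x x≢0)))
    where
    x≢0 : x ≢ 0#
    x≢0 x≡0 = 1≢0 (trans (sym xy≡1) (trans (cong (_* y) x≡0) (zeroˡ y)))

  ⁻¹-distrib-* : ∀ {x y} → x ≢ 0# → y ≢ 0# → (x * y) ⁻¹ ≡ x ⁻¹ * y ⁻¹
  ⁻¹-distrib-* {x} {y} x≢0 y≢0 = sym (⁻¹-unique (begin
    (x * y) * (x ⁻¹ * y ⁻¹)    ≡⟨ *-interchange x y (x ⁻¹) (y ⁻¹) ⟩
    (x * x ⁻¹) * (y * y ⁻¹)    ≡⟨ cong₂ _*_ (⁻¹-inverse x x≢0) (⁻¹-inverse y y≢0) ⟩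
    1# * 1#                    ≡⟨ *-identityˡ 1# ⟩
    1#                         ∎))

  1⁻¹≡1 : 1# ⁻¹ ≡ 1#
  1⁻¹≡1 = sym (⁻¹-unique (*-identityˡ 1#))

  ^-distribˡ-+-* : ∀ x m n → x ^ (m ℕ.+ n) ≡ x ^ m * x ^ n
  ^-distribˡ-+-* x zero    n = sym (*-identityˡ _)
  ^-distribˡ-+-* x (suc m) n = trans (cong (x *_) (^-distribˡ-+-* x m n)) (sym (*-assoc _ _ _))

  ^-distrib-* : ∀ x y n → (x * y) ^ n ≡ x ^ n * y ^ n
  ^-distrib-* x y zero    = sym (*-identityˡ 1#)
  ^-distrib-* x y (suc n) = trans (cong ((x * y) *_) (^-distrib-* x y n)) (*-interchange x y (x ^ n) (y ^ n))

  0^n≡0 : ∀ {n} → n ≢ 0 → 0# ^ n ≡ 0#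
  0^n≡0 {zero}  0≢0 = ⊥-elim (0≢0 refl)
  0^n≡0 {suc n} _   = zeroˡ _

  1^n≡1 : ∀ n → 1# ^ n ≡ 1#
  1^n≡1 zero    = refl
  1^n≡1 (suc n) = trans (*-identityˡ _) (1^n≡1 n)

  ^-*-assoc : ∀ x m n → (x ^ m) ^ n ≡ x ^ (m ℕ.* n)
  ^-*-assoc x zero    n = 1^n≡1 n
  ^-*-assoc x (suc m) n = begin
    (x * x ^ m) ^ n          ≡⟨ ^-distrib-* x (x ^ m) n ⟩
    x ^ n * (x ^ m) ^ n      ≡⟨ cong (x ^ n *_) (^-*-assoc x m n) ⟩
    x ^ n * x ^ (m ℕ.* n)    ≡⟨ sym (^-distribˡ-+-* x n (m ℕ.* n)) ⟩
    x ^ (n ℕ.+ m ℕ.* n)      ∎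

  0*x≡0*y : ∀ {c} x y → c ≡ 0# → c * x ≡ c * y
  0*x≡0*y {c} x y c≡0 = trans (cong (_* x) c≡0) (trans (zeroˡ x) (sym (trans (cong (_* y) c≡0) (zeroˡ y))))

  x-y≡0⇒x≡y : ∀ {x y} → x + - y ≡ 0# → x ≡ y
  x-y≡0⇒x≡y {x} {y} x-y≡0 = sym (-‿injective (+-inverseʳ-unique x (- y) x-y≡0))


  natF≡×1 : ∀ n → natF n ≡ n ×ᵤ 1#
  natF≡×1 zero    = refl
  natF≡×1 (suc n) = cong (1# +_) (natF≡×1 n)

  natF-+ : ∀ m n → natF (m ℕ.+ n) ≡ natF m + natF n
  natF-+ m n = trans (natF≡×1 (m ℕ.+ n))
    (trans (×-homo-+ 1# m n) (sym (cong₂ _+_ (natF≡×1 m) (natF≡×1 n))))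

  natF-* : ∀ m n → natF (m ℕ.* n) ≡ natF m * natF n
  natF-* m n = trans (natF≡×1 (m ℕ.* n))
    (trans (×1-homo-* m n) (sym (cong₂ _*_ (natF≡×1 m) (natF≡×1 n))))

  ×ᵤ≡natF* : ∀ n x → n ×ᵤ x ≡ natF n * x
  ×ᵤ≡natF* n x = begin
    n ×ᵤ x           ≡⟨ cong (n ×ᵤ_) (sym (*-identityˡ x)) ⟩
    n ×ᵤ (1# * x)    ≡⟨ sym (×-assoc-* n 1# x) ⟩
    (n ×ᵤ 1#) * x    ≡⟨ cong (_* x) (sym (natF≡×1 n)) ⟩
    natF n * x       ∎

  sumBelow-cong : ∀ n {f g : ℕ → Carrier} → (∀ i → i < n → f i ≡ g i) → sumBelow n f ≡ sumBelow n g
  sumBelow-cong zero    f≗g = refl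
  sumBelow-cong (suc n) f≗g = cong₂ _+_ (sumBelow-cong n (λ i i<n → f≗g i (ℕ.m<n⇒m<1+n i<n))) (f≗g n (ℕ.n<1+n n))

  sumBelow-zero : ∀ n {f : ℕ → Carrier} → (∀ i → i < n → f i ≡ 0#) → sumBelow n f ≡ 0#
  sumBelow-zero n {f} f≗0 = trans (sumBelow-cong n f≗0) (zero-sum n)
    where
    zero-sum : ∀ n → sumBelow n (λ _ → 0#) ≡ 0#
    zero-sum zero    = refl
    zero-sum (suc n) = trans (+-identityʳ _) (zero-sum n)

  sumBelow-distrib-+ : ∀ n (f g : ℕ → Carrier) → sumBelow n (λ i → f i + g i) ≡ sumBelow n f + sumBelow n g
  sumBelow-distrib-+ zero    f g = sym (+-identityˡ 0#)
  sumBelow-distrib-+ (suc n) f g = trans (cong (_+ (f n + g n)) (sumBelow-distrib-+ n f g)) (+-interchange _ _ _ _)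

  *-distribˡ-sumBelow : ∀ n c (f : ℕ → Carrier) → c * sumBelow n f ≡ sumBelow n (λ i → c * f i)
  *-distribˡ-sumBelow zero    c f = zeroʳ c
  *-distribˡ-sumBelow (suc n) c f = trans (distribˡ _ _ _) (cong (_+ (c * f n)) (*-distribˡ-sumBelow n c f))

  *-distribʳ-sumBelow : ∀ n c (f : ℕ → Carrier) → sumBelow n f * c ≡ sumBelow n (λ i → f i * c)
  *-distribʳ-sumBelow n c f = trans (*-comm _ _)
    (trans (*-distribˡ-sumBelow n c f) (sumBelow-cong n (λ i _ → *-comm c (f i))))

  -‿sumBelow : ∀ n (f : ℕ → Carrier) → - sumBelow n f ≡ sumBelow n (λ i → - f i)
  -‿sumBelow n f = trans (sym (-1*x≈-x _)) (trans (*-distribˡ-sumBelow n (- 1#) f) (sumBelow-cong n (λ i _ → -1*x≈-x (f i))))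

  sumBelow-suc : ∀ n (f : ℕ → Carrier) → sumBelow (suc n) f ≡ f 0 + sumBelow n (f ∘ suc)
  sumBelow-suc zero    f = trans (+-identityˡ _) (sym (+-identityʳ _))
  sumBelow-suc (suc n) f = trans (cong (_+ f (suc n)) (sumBelow-suc n f)) (+-assoc _ _ _)

  sumBelow-+ : ∀ m n (f : ℕ → Carrier) → sumBelow (m ℕ.+ n) f ≡ sumBelow m f + sumBelow n (λ i → f (m ℕ.+ i))
  sumBelow-+ m zero    f = trans (cong (λ k → sumBelow k f) (ℕ.+-identityʳ m)) (sym (+-identityʳ _))
  sumBelow-+ m (suc n) f = begin
    sumBelow (m ℕ.+ suc n) f                                      ≡⟨ cong (λ k → sumBelow k f) (ℕ.+-suc m n) ⟩
    sumBelow (m ℕ.+ n) f + f (m ℕ.+ n)                            ≡⟨ cong (_+ f (m ℕ.+ n)) (sumBelow-+ m n f) ⟩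
    (sumBelow m f + sumBelow n (λ i → f (m ℕ.+ i))) + f (m ℕ.+ n) ≡⟨ +-assoc _ _ _ ⟩
    sumBelow m f + sumBelow (suc n) (λ i → f (m ℕ.+ i))           ∎

  sumBelow-extend : ∀ {m n} (f : ℕ → Carrier) → m ≤ n → (∀ i → m ≤ i → i < n → f i ≡ 0#) →
                    sumBelow m f ≡ sumBelow n f
  sumBelow-extend {m} f m≤n tail≡0 with ℕ.m≤n⇒∃[o]m+o≡n m≤n
  ... | o , refl = sym (begin
    sumBelow (m ℕ.+ o) f                           ≡⟨ sumBelow-+ m o f ⟩
    sumBelow m f + sumBelow o (λ i → f (m ℕ.+ i))  ≡⟨ cong (sumBelow m f +_) (sumBelow-zero o tail′≡0) ⟩
    sumBelow m f + 0#                              ≡⟨ +-identityʳ _ ⟩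
    sumBelow m f                                   ∎)
    where
    tail′≡0 : ∀ i → i < o → f (m ℕ.+ i) ≡ 0#
    tail′≡0 i i<o = tail≡0 (m ℕ.+ i) (ℕ.m≤m+n m i) (ℕ.+-monoʳ-< m i<o)

  sumBelow-single : ∀ n {f : ℕ → Carrier} j → j < n → (∀ i → i < n → i ≢ j → f i ≡ 0#) → sumBelow n f ≡ f j
  sumBelow-single (suc n) {f} j j<1+n others≡0 with j ℕ.≟ n
  ... | yes refl = trans (cong (_+ f j) (sumBelow-zero n (λ i i<n → others≡0 i (ℕ.m<n⇒m<1+n i<n) (ℕ.<⇒≢ i<n))))
                         (+-identityˡ _)
  ... | no j≢n   = trans (cong₂ _+_ (sumBelow-single n j (ℕ.≤∧≢⇒< (ℕ.≤-pred j<1+n) j≢n)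
                                                      (λ i i<n → others≡0 i (ℕ.m<n⇒m<1+n i<n)))
                                    (others≡0 n (ℕ.n<1+n n) (j≢n ∘ sym)))
                         (+-identityʳ _)

  sumBelow-comm : ∀ m n (f : ℕ → ℕ → Carrier) →
                  sumBelow m (λ i → sumBelow n (f i)) ≡ sumBelow n (λ j → sumBelow m (λ i → f i j))
  sumBelow-comm zero    n f = sym (sumBelow-zero n (λ _ _ → refl))
  sumBelow-comm (suc m) n f = trans (cong (_+ sumBelow n (f m)) (sumBelow-comm m n f))
                                    (sym (sumBelow-distrib-+ n _ (f m)))

  sumBelow-* : ∀ m n (f : ℕ → Carrier) →
               sumBelow (m ℕ.* n) f ≡ sumBelow n (λ b → sumBelow m (λ a → f (a ℕ.+ m ℕ.* b)))
  sumBelow-* m zero    f = cong (λ k → sumBelow k f) (ℕ.*-zeroʳ m)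
  sumBelow-* m (suc n) f = begin
    sumBelow (m ℕ.* suc n) f
      ≡⟨ cong (λ k → sumBelow k f) (trans (ℕ.*-suc m n) (ℕ.+-comm m (m ℕ.* n))) ⟩
    sumBelow (m ℕ.* n ℕ.+ m) f
      ≡⟨ sumBelow-+ (m ℕ.* n) m f ⟩
    sumBelow (m ℕ.* n) f + sumBelow m (λ a → f (m ℕ.* n ℕ.+ a))
      ≡⟨ cong₂ _+_ (sumBelow-* m n f) (sumBelow-cong m (λ a _ → cong f (ℕ.+-comm (m ℕ.* n) a))) ⟩
    sumBelow (suc n) (λ b → sumBelow m (λ a → f (a ℕ.+ m ℕ.* b))) ∎

  sumBelow≡∑ : ∀ n (f : ℕ → Carrier) → sumBelow n f ≡ ∑[ i < n ] f (toℕ i)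
  sumBelow≡∑ zero    f = refl
  sumBelow≡∑ (suc n) f = trans (sumBelow-suc n f) (cong (f 0 +_) (sumBelow≡∑ n (f ∘ suc)))

  sumF-zero : ∀ (f : Carrier → Carrier) xs → (∀ x → x ∈ xs → f x ≡ 0#) → sumF (map f xs) ≡ 0#
  sumF-zero f []       f≗0 = refl
  sumF-zero f (x ∷ xs) f≗0 =
    trans (cong₂ _+_ (f≗0 x (here refl)) (sumF-zero f xs (λ y y∈ → f≗0 y (there y∈)))) (+-identityˡ 0#)

  sumF-single : ∀ (f : Carrier → Carrier) {xs} w → Unique xs → w ∈ xs → (∀ x → x ∈ xs → x ≢ w → f x ≡ 0#) →
                sumF (map f xs) ≡ f w
  sumF-single f {x ∷ xs} w (x∉xs ∷ _) (here refl) others≡0 =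
    trans (cong (f x +_) (sumF-zero f xs (λ y y∈ → others≡0 y (there y∈) (All.lookup x∉xs y∈ ∘ sym)))) (+-identityʳ _)
  sumF-single f {x ∷ xs} w (x∉xs ∷ xs-unique) (there w∈) others≡0 =
    trans (cong₂ _+_ (others≡0 x (here refl) (All.lookup x∉xs w∈))
                     (sumF-single f w xs-unique w∈ (λ y y∈ → others≡0 y (there y∈))))
          (+-identityˡ _)

  sumF-sumBelow : ∀ xs n (f : Carrier → ℕ → Carrier) →
                  sumF (map (λ x → sumBelow n (f x)) xs) ≡ sumBelow n (λ j → sumF (map (λ x → f x j) xs))
  sumF-sumBelow []       n f = sym (sumBelow-zero n (λ _ _ → refl))
  sumF-sumBelow (x ∷ xs) n f = trans (cong (sumBelow n (f x) +_) (sumF-sumBelow xs n f)) (sym (sumBelow-distrib-+ n (f x) _))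

  *-distribʳ-sumF : ∀ xs (f : Carrier → Carrier) c → sumF (map f xs) * c ≡ sumF (map (λ x → f x * c) xs)
  *-distribʳ-sumF []       f c = zeroˡ c
  *-distribʳ-sumF (x ∷ xs) f c = trans (distribʳ _ _ _) (cong (f x * c +_) (*-distribʳ-sumF xs f c))

  δ : ℕ → ℕ → Carrier
  δ k j with j ℕ.≟ k
  ... | yes _ = 1#
  ... | no  _ = 0#

  δ-diag : ∀ k → δ k k ≡ 1#
  δ-diag k with k ℕ.≟ k
  ... | yes _   = refl
  ... | no  k≢k = ⊥-elim (k≢k refl)

  δ-off : ∀ {k j} → j ≢ k → δ k j ≡ 0#
  δ-off {k} {j} j≢k with j ℕ.≟ k
  ... | yes j≡k = ⊥-elim (j≢k j≡k)
  ... | no  _   = refl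

  sumBelow-δ : ∀ {n k} (f : ℕ → Carrier) → k < n → sumBelow n (λ j → δ k j * f j) ≡ f k
  sumBelow-δ {n} {k} f k<n = trans (sumBelow-single n k k<n (λ j _ j≢k → trans (cong (_* f j) (δ-off j≢k)) (zeroˡ _)))
                                   (trans (cong (_* f k) (δ-diag k)) (*-identityˡ _))

  lastNonZero : ∀ n (c : ℕ → Carrier) →
                (∀ j → j < n → c j ≡ 0#) ⊎ Σ ℕ (λ J → J < n × c J ≢ 0# × (∀ j → J < j → j < n → c j ≡ 0#))
  lastNonZero zero    c = inj₁ (λ _ ())
  lastNonZero (suc n) c with c n ≟ 0# | lastNonZero n c
  ... | no  cₙ≢0 | _ = inj₂ (n , ℕ.n<1+n n , cₙ≢0 , λ j n<j j<1+n → ⊥-elim (ℕ.<⇒≱ n<j (ℕ.≤-pred j<1+n)))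
  ... | yes cₙ≡0 | inj₁ below≡0 =
    inj₁ (λ j j<1+n → [ below≡0 j , (λ j≡n → trans (cong c j≡n) cₙ≡0) ]′ (ℕ.m<1+n⇒m<n∨m≡n j<1+n))
  ... | yes cₙ≡0 | inj₂ (J , J<n , c_J≢0 , above≡0) =
    inj₂ (J , ℕ.m<n⇒m<1+n J<n , c_J≢0 ,
          λ j J<j j<1+n → [ above≡0 j J<j , (λ j≡n → trans (cong c j≡n) cₙ≡0) ]′ (ℕ.m<1+n⇒m<n∨m≡n j<1+n))


  ^≡^ₛ : ∀ x n → x ^ n ≡ x ^ₛ n
  ^≡^ₛ x zero    = refl
  ^≡^ₛ x (suc n) = cong (x *_) (^≡^ₛ x n)

  binomial : ∀ n x y → (x + y) ^ n ≡ sumBelow (suc n) (λ i → natF (n C i) * (x ^ i * y ^ (n ∸ i)))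
  binomial n x y = begin
    (x + y) ^ n                                                   ≡⟨ ^≡^ₛ (x + y) n ⟩
    (x + y) ^ₛ n                                                  ≡⟨ Binomial.theorem n x y ⟩
    Binomial.binomialExpansion x y n                              ≡⟨ sym (sumBelow≡∑ (suc n) _) ⟩
    sumBelow (suc n) (λ i → (n C i) ×ᵤ (x ^ₛ i * y ^ₛ (n ∸ i)))   ≡⟨ sumBelow-cong (suc n) (λ i _ → term i) ⟩
    sumBelow (suc n) (λ i → natF (n C i) * (x ^ i * y ^ (n ∸ i))) ∎
    where
    term : ∀ i → (n C i) ×ᵤ (x ^ₛ i * y ^ₛ (n ∸ i)) ≡ natF (n C i) * (x ^ i * y ^ (n ∸ i))
    term i = trans (×ᵤ≡natF* (n C i) _) (cong (natF (n C i) *_) (sym (cong₂ _*_ (^≡^ₛ x i) (^≡^ₛ y (n ∸ i)))))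

n∣n! : ∀ n → .{{NonZero n}} → n ∣ n !
n∣n! (suc n) = m∣m*n (n !)

module PrimeBinomials {p : ℕ} (p-prime : Prime p) where

  private instance
    p≢0 : NonZero p
    p≢0 = prime⇒nonZero p-prime

  p∤small : ∀ {m} → 0 < m → m < p → p ∤ m
  p∤small 0<m m<p p∣m = ℕ.<⇒≱ m<p (∣⇒≤ {{ℕ.>-nonZero 0<m}} p∣m)

  p∤m! : ∀ {m} → m < p → p ∤ m !
  p∤m! {zero}  _     = p∤small (s≤s z≤n) (ℕ.nonTrivial⇒n>1 p {{prime⇒nonTrivial p-prime}})
  p∤m! {suc m} 1+m<p p∣[1+m]! with euclidsLemma (suc m) (m !) p-prime p∣[1+m]!
  ... | inj₁ p∣1+m = p∤small (s≤s z≤n) 1+m<p p∣1+m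
  ... | inj₂ p∣m!  = p∤m! (ℕ.<-trans (ℕ.n<1+n m) 1+m<p) p∣m!

  nCk*k![n∸k]!≡n! : ∀ {n k} → k ≤ n → (n C k) ℕ.* (k ! ℕ.* (n ∸ k) !) ≡ n !
  nCk*k![n∸k]!≡n! {n} {k} k≤n =
    trans (cong (ℕ._* (k ! ℕ.* (n ∸ k) !)) (nCk≡n!/k![n-k]! k≤n))
          (m/n*n≡m {{k ℕ.!* (n ∸ k) !≢0}} (k![n∸k]!∣n! k≤n))

  p∣pCk : ∀ {k} → 0 < k → k < p → p ∣ p C k
  p∣pCk {k} 0<k k<p
    with euclidsLemma (p C k) _ p-prime (subst (p ∣_) (sym (nCk*k![n∸k]!≡n! (ℕ.<⇒≤ k<p))) (n∣n! p))
  ... | inj₁ p∣pCk = p∣pCk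
  ... | inj₂ p∣k![p∸k]! with euclidsLemma (k !) ((p ∸ k) !) p-prime p∣k![p∸k]!
  ...   | inj₁ p∣k!     = ⊥-elim (p∤m! k<p p∣k!)
  ...   | inj₂ p∣[p∸k]! = ⊥-elim (p∤m! (ℕ.∸-monoʳ-< 0<k (ℕ.<⇒≤ k<p)) p∣[p∸k]!)

  p∤nCk : ∀ {n k} → k ≤ n → n < p → p ∤ n C k
  p∤nCk k≤n n<p p∣nCk = p∤m! n<p (subst (p ∣_) (nCk*k![n∸k]!≡n! k≤n) (∣m⇒∣m*n _ p∣nCk))

module Digits (p : ℕ) .{{_ : NonZero p}} where

  m≡m%p+p*[m/p] : ∀ m → m ≡ m % p ℕ.+ p ℕ.* (m / p)
  m≡m%p+p*[m/p] m = trans (m≡m%n+[m/n]*n m p) (cong (m % p ℕ.+_) (ℕ.*-comm (m / p) p))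

  [a+p*b]%p≡a : ∀ {a} b → a < p → (a ℕ.+ p ℕ.* b) % p ≡ a
  [a+p*b]%p≡a {a} b a<p = begin
    (a ℕ.+ p ℕ.* b) % p   ≡⟨ cong (λ n → (a ℕ.+ n) % p) (ℕ.*-comm p b) ⟩
    (a ℕ.+ b ℕ.* p) % p   ≡⟨ [m+kn]%n≡m%n a b p ⟩
    a % p                 ≡⟨ m<n⇒m%n≡m a<p ⟩
    a                     ∎
    where open ≡-Reasoning

  [a+p*b]/p≡b : ∀ {a} b → a < p → (a ℕ.+ p ℕ.* b) / p ≡ b
  [a+p*b]/p≡b {a} b a<p = begin
    (a ℕ.+ p ℕ.* b) / p     ≡⟨ +-distrib-/-∣ʳ a (m∣m*n b) ⟩
    a / p ℕ.+ p ℕ.* b / p   ≡⟨ cong₂ ℕ._+_ (m<n⇒m/n≡0 a<p) (trans (cong (_/ p) (ℕ.*-comm p b)) (m*n/n≡m b p)) ⟩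
    b                       ∎
    where open ≡-Reasoning

  m<p*p⇒m/p<p : ∀ {m} → m < p ℕ.* p → m / p < p
  m<p*p⇒m/p<p = m<n*o⇒m/o<n

  [a+p*b]∸[c+p*d] : ∀ {a b c d} → c ≤ a → d ≤ b →
                    (a ℕ.+ p ℕ.* b) ∸ (c ℕ.+ p ℕ.* d) ≡ (a ∸ c) ℕ.+ p ℕ.* (b ∸ d)
  [a+p*b]∸[c+p*d] {c = c} {d} c≤a d≤b with ℕ.m≤n⇒∃[o]m+o≡n c≤a | ℕ.m≤n⇒∃[o]m+o≡n d≤b
  ... | e , refl | f , refl = begin
    (c ℕ.+ e ℕ.+ p ℕ.* (d ℕ.+ f)) ∸ (c ℕ.+ p ℕ.* d)
      ≡⟨ cong (_∸ (c ℕ.+ p ℕ.* d)) (regroup p c e d f) ⟩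
    ((c ℕ.+ p ℕ.* d) ℕ.+ (e ℕ.+ p ℕ.* f)) ∸ (c ℕ.+ p ℕ.* d)
      ≡⟨ ℕ.m+n∸m≡n (c ℕ.+ p ℕ.* d) _ ⟩
    e ℕ.+ p ℕ.* f
      ≡⟨ sym (cong₂ (λ x y → x ℕ.+ p ℕ.* y) (ℕ.m+n∸m≡n c e) (ℕ.m+n∸m≡n d f)) ⟩
    (c ℕ.+ e ∸ c) ℕ.+ p ℕ.* (d ℕ.+ f ∸ d)
      ∎
    where
    open ≡-Reasoning
    regroup : ∀ p c e d f → c ℕ.+ e ℕ.+ p ℕ.* (d ℕ.+ f) ≡ (c ℕ.+ p ℕ.* d) ℕ.+ (e ℕ.+ p ℕ.* f)
    regroup = solve-∀

  infix 4 _≼_ _≼?_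

  _≼_ : ℕ → ℕ → Set
  j ≼ k = j % p ≤ k % p × j / p ≤ k / p

  _≼?_ : ∀ j k → Dec (j ≼ k)
  j ≼? k = (j % p ℕ.≤? k % p) ×-dec (j / p ℕ.≤? k / p)

  ≼-refl : ∀ {k} → k ≼ k
  ≼-refl = ℕ.≤-refl , ℕ.≤-refl

  ≼-trans : ∀ {i j k} → i ≼ j → j ≼ k → i ≼ k
  ≼-trans (i₀≤j₀ , i₁≤j₁) (j₀≤k₀ , j₁≤k₁) = ℕ.≤-trans i₀≤j₀ j₀≤k₀ , ℕ.≤-trans i₁≤j₁ j₁≤k₁

  ≼⇒≤ : ∀ {j k} → j ≼ k → j ≤ k
  ≼⇒≤ {j} {k} (j₀≤k₀ , j₁≤k₁) =
    subst₂ _≤_ (sym (m≡m%p+p*[m/p] j)) (sym (m≡m%p+p*[m/p] k)) (ℕ.+-mono-≤ j₀≤k₀ (ℕ.*-monoʳ-≤ p j₁≤k₁))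

  ∸-digits : ∀ {j k} → j ≼ k → (k ∸ j) % p ≡ k % p ∸ j % p × (k ∸ j) / p ≡ k / p ∸ j / p
  ∸-digits {j} {k} (j₀≤k₀ , j₁≤k₁) =
    subst (λ n → n % p ≡ k % p ∸ j % p × n / p ≡ k / p ∸ j / p) (sym k∸j≡)
          ([a+p*b]%p≡a (k / p ∸ j / p) lt , [a+p*b]/p≡b (k / p ∸ j / p) lt)
    where
    k∸j≡ : k ∸ j ≡ (k % p ∸ j % p) ℕ.+ p ℕ.* (k / p ∸ j / p)
    k∸j≡ = trans (cong₂ _∸_ (m≡m%p+p*[m/p] k) (m≡m%p+p*[m/p] j)) ([a+p*b]∸[c+p*d] j₀≤k₀ j₁≤k₁)
    lt : k % p ∸ j % p < p
    lt = ℕ.≤-<-trans (ℕ.m∸n≤m (k % p) (j % p)) (m%n<n k p)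

  ∸-≼ : ∀ {j k} → j ≼ k → k ∸ j ≼ k
  ∸-≼ {j} {k} j≼k with ∸-digits j≼k
  ... | d₀ , d₁ = subst (_≤ k % p) (sym d₀) (ℕ.m∸n≤m (k % p) (j % p)) ,
                  subst (_≤ k / p) (sym d₁) (ℕ.m∸n≤m (k / p) (j / p))

  Preceq⇒≼ : ∀ {j k} → Preceq p j k → j ≼ k
  Preceq⇒≼ (k₀ , k₁ , j₀ , j₁ , (k₀<p , _ , refl) , (j₀<p , _ , refl) , j₀≤k₀ , j₁≤k₁) =
    subst₂ _≤_ (sym ([a+p*b]%p≡a j₁ j₀<p)) (sym ([a+p*b]%p≡a k₁ k₀<p)) j₀≤k₀ ,
    subst₂ _≤_ (sym ([a+p*b]/p≡b j₁ j₀<p)) (sym ([a+p*b]/p≡b k₁ k₀<p)) j₁≤k₁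

  ≼⇒Preceq : ∀ {j k} → k < p ℕ.* p → j ≼ k → Preceq p j k
  ≼⇒Preceq {j} {k} k<p*p (j₀≤k₀ , j₁≤k₁) =
    k % p , k / p , j % p , j / p ,
    (m%n<n k p , m<p*p⇒m/p<p k<p*p , m≡m%p+p*[m/p] k) ,
    (m%n<n j p , ℕ.≤-<-trans j₁≤k₁ (m<p*p⇒m/p<p k<p*p) , m≡m%p+p*[m/p] j) ,
    j₀≤k₀ , j₁≤k₁

  digitBinomial : ℕ → ℕ → ℕ
  digitBinomial k j = ((k % p) C (j % p)) ℕ.* ((k / p) C (j / p))

  digitBinomial-diag : ∀ k → digitBinomial k k ≡ 1
  digitBinomial-diag k = cong₂ ℕ._*_ (nCn≡1 (k % p)) (nCn≡1 (k / p))

  digitBinomial-⋠ : ∀ {k j} → ¬ j ≼ k → digitBinomial k j ≡ 0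
  digitBinomial-⋠ {k} {j} j⋠k with j % p ℕ.≤? k % p | j / p ℕ.≤? k / p
  ... | yes j₀≤k₀ | yes j₁≤k₁ = ⊥-elim (j⋠k (j₀≤k₀ , j₁≤k₁))
  ... | no  j₀≰k₀ | _         = cong (ℕ._* ((k / p) C (j / p))) (k>n⇒nCk≡0 (ℕ.≰⇒> j₀≰k₀))
  ... | yes _     | no j₁≰k₁  = trans (cong (((k % p) C (j % p)) ℕ.*_) (k>n⇒nCk≡0 (ℕ.≰⇒> j₁≰k₁)))
                                      (ℕ.*-zeroʳ ((k % p) C (j % p)))

module PrimeCharacteristic (F : Field) (p : ℕ) (p-prime : Prime p) (char-p : Rep.natF F p p ≡ Field.0# F) where

  open FieldLemmas F p public
  open PrimeBinomials p-prime public

  instance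
    p≢0 : NonZero p
    p≢0 = prime⇒nonZero p-prime

  open Digits p public
  open ≡-Reasoning

  0<p : 0 < p
  0<p = ℕ.>-nonZero⁻¹ p

  1<q : 1 < q
  1<q = ℕ.<-≤-trans (ℕ.nonTrivial⇒n>1 p {{prime⇒nonTrivial p-prime}}) (ℕ.m≤m*n p p)

  0<q : 0 < q
  0<q = ℕ.<-trans (s≤s z≤n) 1<q

  q≡1+[q∸1] : q ≡ suc (q ∸ 1)
  q≡1+[q∸1] = sym (ℕ.m+[n∸m]≡n (ℕ.<⇒≤ 1<q))

  natF-*-≡0 : ∀ c {m} → natF m ≡ 0# → natF (c ℕ.* m) ≡ 0#
  natF-*-≡0 c {m} m≡0 = trans (natF-* c m) (trans (cong (natF c *_) m≡0) (zeroʳ _))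

  natF-∣ : ∀ {n} → p ∣ n → natF n ≡ 0#
  natF-∣ (divides c refl) = natF-*-≡0 c char-p

  natF-% : ∀ n → natF n ≡ natF (n % p)
  natF-% n = begin
    natF n                               ≡⟨ cong natF (m≡m%p+p*[m/p] n) ⟩
    natF (n % p ℕ.+ p ℕ.* (n / p))       ≡⟨ natF-+ (n % p) _ ⟩
    natF (n % p) + natF (p ℕ.* (n / p))  ≡⟨ cong (natF (n % p) +_) (natF-∣ (m∣m*n (n / p))) ⟩
    natF (n % p) + 0#                    ≡⟨ +-identityʳ _ ⟩
    natF (n % p)                         ∎

  natF≢0-< : ∀ {r} .{{_ : NonZero r}} → r < p → natF r ≢ 0#
  natF≢0-< {r} r<p r≡0 with coprime-Bézout (prime⇒coprime p-prime r<p)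
  ... | Bézout.+- x y eq = 1≢0 (begin
    1#                    ≡⟨ sym (+-identityʳ 1#) ⟩
    1# + 0#               ≡⟨ cong (1# +_) (sym (natF-*-≡0 y r≡0)) ⟩
    natF (1 ℕ.+ y ℕ.* r)  ≡⟨ cong natF eq ⟩
    natF (x ℕ.* p)        ≡⟨ natF-*-≡0 x char-p ⟩
    0#                    ∎)
  ... | Bézout.-+ x y eq = 1≢0 (begin
    1#                    ≡⟨ sym (+-identityʳ 1#) ⟩
    1# + 0#               ≡⟨ cong (1# +_) (sym (natF-*-≡0 x char-p)) ⟩
    natF (1 ℕ.+ x ℕ.* p)  ≡⟨ cong natF eq ⟩
    natF (y ℕ.* r)        ≡⟨ natF-*-≡0 y r≡0 ⟩
    0#                    ∎)

  natF≢0 : ∀ {n} → p ∤ n → natF n ≢ 0#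
  natF≢0 {n} p∤n n≡0 =
    natF≢0-< {{ℕ.≢-nonZero (p∤n ∘ m%n≡0⇒n∣m n p)}} (m%n<n n p) (trans (sym (natF-% n)) n≡0)

  frobenius : ∀ x y → (x + y) ^ p ≡ x ^ p + y ^ p
  frobenius x y = begin
    (x + y) ^ p           ≡⟨ binomial p x y ⟩
    sumBelow p t + t p    ≡⟨ cong (_+ t p) (sumBelow-single p 0 0<p inner≡0) ⟩
    t 0 + t p             ≡⟨ cong₂ _+_ t₀ tₚ ⟩
    y ^ p + x ^ p         ≡⟨ +-comm _ _ ⟩
    x ^ p + y ^ p         ∎
    where
    t : ℕ → Carrier
    t i = natF (p C i) * (x ^ i * y ^ (p ∸ i))
    inner≡0 : ∀ i → i < p → i ≢ 0 → t i ≡ 0#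
    inner≡0 i i<p i≢0 = trans (cong (_* (x ^ i * y ^ (p ∸ i))) (natF-∣ (p∣pCk (ℕ.n≢0⇒n>0 i≢0) i<p))) (zeroˡ _)
    t₀ : t 0 ≡ y ^ p
    t₀ = solve 1 (λ a → (con 1ℤ :+ con 0ℤ) :* (con 1ℤ :* a) := a) refl (y ^ p)
    tₚ : t p ≡ x ^ p
    tₚ = begin
      natF (p C p) * (x ^ p * y ^ (p ∸ p))  ≡⟨ cong₂ (λ c n → natF c * (x ^ p * y ^ n)) (nCn≡1 p) (ℕ.n∸n≡0 p) ⟩
      (1# + 0#) * (x ^ p * 1#)              ≡⟨ solve 1 (λ a → (con 1ℤ :+ con 0ℤ) :* (a :* con 1ℤ) := a) refl (x ^ p) ⟩
      x ^ p                                 ∎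

  frobenius-q : ∀ x y → (x + y) ^ q ≡ x ^ q + y ^ q
  frobenius-q x y = begin
    (x + y) ^ (p ℕ.* p)        ≡⟨ sym (^-*-assoc (x + y) p p) ⟩
    ((x + y) ^ p) ^ p          ≡⟨ cong (_^ p) (frobenius x y) ⟩
    (x ^ p + y ^ p) ^ p        ≡⟨ frobenius _ _ ⟩
    (x ^ p) ^ p + (y ^ p) ^ p  ≡⟨ cong₂ _+_ (^-*-assoc x p p) (^-*-assoc y p p) ⟩
    x ^ q + y ^ q              ∎

  choose : ℕ → ℕ → Carrier
  choose k j = natF (digitBinomial k j)

  choose-⋠ : ∀ {k j} → ¬ j ≼ k → choose k j ≡ 0#
  choose-⋠ j⋠k = cong natF (digitBinomial-⋠ j⋠k)

  choose-≼ : ∀ {k j} → k < q → j ≼ k → choose k j ≢ 0#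
  choose-≼ {k} {j} k<q (j₀≤k₀ , j₁≤k₁) = natF≢0 p∤
    where
    p∤ : p ∤ digitBinomial k j
    p∤ p∣ with euclidsLemma ((k % p) C (j % p)) ((k / p) C (j / p)) p-prime p∣
    ... | inj₁ p∣₀ = p∤nCk j₀≤k₀ (m%n<n k p) p∣₀
    ... | inj₂ p∣₁ = p∤nCk j₁≤k₁ (m<p*p⇒m/p<p k<q) p∣₁

  choose-diag : ∀ k → choose k k ≡ 1#
  choose-diag k = trans (cong natF (digitBinomial-diag k)) (+-identityʳ 1#)

  choose-digits : ∀ k {a} b → a < p → choose k (a ℕ.+ p ℕ.* b) ≡ natF ((k % p) C a) * natF ((k / p) C b)
  choose-digits k {a} b a<p =
    trans (cong₂ (λ a′ b′ → natF (((k % p) C a′) ℕ.* ((k / p) C b′))) ([a+p*b]%p≡a b a<p) ([a+p*b]/p≡b b a<p))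
          (natF-* ((k % p) C a) ((k / p) C b))

  natF[nCk]≡0 : ∀ {n k} → n < k → natF (n C k) ≡ 0#
  natF[nCk]≡0 n<k = cong natF (k>n⇒nCk≡0 n<k)

  binomial-extended : ∀ {n m} x y → n < m → (x + y) ^ n ≡ sumBelow m (λ i → natF (n C i) * (x ^ i * y ^ (n ∸ i)))
  binomial-extended {n} x y n<m = trans (binomial n x y)
    (sumBelow-extend _ n<m (λ i n<i _ → trans (cong (_* (x ^ i * y ^ (n ∸ i))) (natF[nCk]≡0 n<i)) (zeroˡ _)))

  ^-digits : ∀ z a b → z ^ a * (z ^ p) ^ b ≡ z ^ (a ℕ.+ p ℕ.* b)
  ^-digits z a b = trans (cong (z ^ a *_) (^-*-assoc z p b)) (sym (^-distribˡ-+-* z a (p ℕ.* b)))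

  lucas-term : ∀ k {a} b x y → a < p →
               natF ((k % p) C a) * (x ^ a * y ^ (k % p ∸ a)) * (natF ((k / p) C b) * ((x ^ p) ^ b * (y ^ p) ^ (k / p ∸ b)))
               ≡ choose k (a ℕ.+ p ℕ.* b) * (x ^ (a ℕ.+ p ℕ.* b) * y ^ (k ∸ (a ℕ.+ p ℕ.* b)))
  lucas-term k {a} b x y a<p = begin
    (c₀ * (x ^ a * y ^ (k₀ ∸ a))) * (c₁ * ((x ^ p) ^ b * (y ^ p) ^ (k₁ ∸ b)))
      ≡⟨ solve 6 (λ c₀ c₁ xa ya xb yb → (c₀ :* (xa :* ya)) :* (c₁ :* (xb :* yb)) := (c₀ :* c₁) :* ((xa :* xb) :* (ya :* yb)))
               refl c₀ c₁ (x ^ a) (y ^ (k₀ ∸ a)) ((x ^ p) ^ b) ((y ^ p) ^ (k₁ ∸ b)) ⟩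
    (c₀ * c₁) * ((x ^ a * (x ^ p) ^ b) * (y ^ (k₀ ∸ a) * (y ^ p) ^ (k₁ ∸ b)))
      ≡⟨ cong₂ (λ u w → (c₀ * c₁) * (u * w)) (^-digits x a b) (^-digits y (k₀ ∸ a) (k₁ ∸ b)) ⟩
    (c₀ * c₁) * (x ^ j * y ^ (k₀ ∸ a ℕ.+ p ℕ.* (k₁ ∸ b)))
      ≡⟨ y-exponent ⟩
    (c₀ * c₁) * (x ^ j * y ^ (k ∸ j))
      ≡⟨ cong (_* (x ^ j * y ^ (k ∸ j))) (sym (choose-digits k b a<p)) ⟩
    choose k j * (x ^ j * y ^ (k ∸ j))
      ∎
    where
    k₀ = k % p
    k₁ = k / p
    j = a ℕ.+ p ℕ.* b
    c₀ = natF (k₀ C a)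
    c₁ = natF (k₁ C b)
    -- The exponents agree unless a > k₀ or b > k₁, and then the coefficient vanishes.
    y-exponent : (c₀ * c₁) * (x ^ j * y ^ (k₀ ∸ a ℕ.+ p ℕ.* (k₁ ∸ b))) ≡ (c₀ * c₁) * (x ^ j * y ^ (k ∸ j))
    y-exponent with a ℕ.≤? k₀ | b ℕ.≤? k₁
    ... | yes a≤k₀ | yes b≤k₁ = cong (λ n → (c₀ * c₁) * (x ^ j * y ^ n))
                                     (sym (trans (cong (_∸ j) (m≡m%p+p*[m/p] k)) ([a+p*b]∸[c+p*d] a≤k₀ b≤k₁)))
    ... | no a≰k₀  | _        = 0*x≡0*y _ _ (trans (cong (_* c₁) (natF[nCk]≡0 (ℕ.≰⇒> a≰k₀))) (zeroˡ c₁))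
    ... | yes _    | no b≰k₁  = 0*x≡0*y _ _ (trans (cong (c₀ *_) (natF[nCk]≡0 (ℕ.≰⇒> b≰k₁))) (zeroʳ c₀))

  -- Lucas' theorem: (x + y)^k = (x + y)^k₀ (x^p + y^p)^k₁, and both factors are expanded binomially.
  lucas : ∀ {k} → k < q → ∀ x y → (x + y) ^ k ≡ sumBelow q (λ j → choose k j * (x ^ j * y ^ (k ∸ j)))
  lucas {k} k<q x y = begin
    (x + y) ^ k
      ≡⟨ cong ((x + y) ^_) (m≡m%p+p*[m/p] k) ⟩
    (x + y) ^ (k₀ ℕ.+ p ℕ.* k₁)
      ≡⟨ ^-distribˡ-+-* (x + y) k₀ (p ℕ.* k₁) ⟩
    (x + y) ^ k₀ * (x + y) ^ (p ℕ.* k₁)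
      ≡⟨ cong ((x + y) ^ k₀ *_) (trans (sym (^-*-assoc (x + y) p k₁)) (cong (_^ k₁) (frobenius x y))) ⟩
    (x + y) ^ k₀ * (x ^ p + y ^ p) ^ k₁
      ≡⟨ cong₂ _*_ (binomial-extended x y (m%n<n k p)) (binomial-extended (x ^ p) (y ^ p) (m<p*p⇒m/p<p k<q)) ⟩
    sumBelow p α * sumBelow p β
      ≡⟨ *-distribˡ-sumBelow p (sumBelow p α) β ⟩
    sumBelow p (λ b → sumBelow p α * β b)
      ≡⟨ sumBelow-cong p (λ b _ → *-distribʳ-sumBelow p (β b) α) ⟩
    sumBelow p (λ b → sumBelow p (λ a → α a * β b))
      ≡⟨ sumBelow-cong p (λ b _ → sumBelow-cong p (λ a a<p → lucas-term k b x y a<p)) ⟩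
    sumBelow p (λ b → sumBelow p (λ a → T (a ℕ.+ p ℕ.* b)))
      ≡⟨ sym (sumBelow-* p p T) ⟩
    sumBelow q T
      ∎
    where
    k₀ = k % p
    k₁ = k / p
    α : ℕ → Carrier
    α a = natF (k₀ C a) * (x ^ a * y ^ (k₀ ∸ a))
    β : ℕ → Carrier
    β b = natF (k₁ C b) * ((x ^ p) ^ b * (y ^ p) ^ (k₁ ∸ b))
    T : ℕ → Carrier
    T j = choose k j * (x ^ j * y ^ (k ∸ j))

  InFq-0 : InFq 0#
  InFq-0 = 0^n≡0 (ℕ.>⇒≢ 0<q)

  InFq-1 : InFq 1#
  InFq-1 = 1^n≡1 q

  InFq-+ : ∀ {x y} → InFq x → InFq y → InFq (x + y)
  InFq-+ {x} {y} xᵠ yᵠ = trans (frobenius-q x y) (cong₂ _+_ xᵠ yᵠ)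

  InFq-* : ∀ {x y} → InFq x → InFq y → InFq (x * y)
  InFq-* {x} {y} xᵠ yᵠ = trans (^-distrib-* x y q) (cong₂ _*_ xᵠ yᵠ)

  InFq-- : ∀ {x} → InFq x → InFq (- x)
  InFq-- {x} xᵠ = trans (+-inverseʳ-unique (x ^ q) ((- x) ^ q) x^q-x^q≡0) (cong -_ xᵠ)
    where
    x^q-x^q≡0 : x ^ q + (- x) ^ q ≡ 0#
    x^q-x^q≡0 = trans (sym (frobenius-q x (- x))) (trans (cong (_^ q) (-‿inverseʳ x)) InFq-0)

  InFq-^ : ∀ {x} n → InFq x → InFq (x ^ n)
  InFq-^ {x} n xᵠ = begin
    (x ^ n) ^ q      ≡⟨ ^-*-assoc x n q ⟩
    x ^ (n ℕ.* q)    ≡⟨ cong (x ^_) (ℕ.*-comm n q) ⟩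
    x ^ (q ℕ.* n)    ≡⟨ sym (^-*-assoc x q n) ⟩
    (x ^ q) ^ n      ≡⟨ cong (_^ n) xᵠ ⟩
    x ^ n            ∎

  InFq-⁻¹ : ∀ {x} → InFq x → x ≢ 0# → InFq (x ⁻¹)
  InFq-⁻¹ {x} xᵠ x≢0 = ⁻¹-unique (begin
    x * (x ⁻¹) ^ q        ≡⟨ cong (_* (x ⁻¹) ^ q) (sym xᵠ) ⟩
    x ^ q * (x ⁻¹) ^ q    ≡⟨ sym (^-distrib-* x (x ⁻¹) q) ⟩
    (x * x ⁻¹) ^ q        ≡⟨ cong (_^ q) (⁻¹-inverse x x≢0) ⟩
    1# ^ q                ≡⟨ 1^n≡1 q ⟩
    1#                    ∎)

  fermat : ∀ {x} → InFq x → x ≢ 0# → x ^ (q ∸ 1) ≡ 1#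
  fermat {x} xᵠ x≢0 = *-cancelˡ _ _ x≢0 (begin
    x * x ^ (q ∸ 1)   ≡⟨ cong (x ^_) (sym q≡1+[q∸1]) ⟩
    x ^ q             ≡⟨ xᵠ ⟩
    x                 ≡⟨ sym (*-identityʳ x) ⟩
    x * 1#            ∎)

module Vandermonde (F : Field) (p : ℕ) where

  open FieldLemmas F p
  open ≡-Reasoning

  record IsSubspace (W : Fun → Set) : Set where
    field
      resp   : ∀ f g → f ≈G g → W f → W g
      zero∈  : W zeroF
      add∈   : ∀ f g → W f → W g → W (addF f g)
      scale∈ : ∀ c f → W f → W (scaleF c f)

  eval : List Fun → Carrier → Fun
  eval []       t x = 0#
  eval (a ∷ as) t x = a x + t * eval as t x

  divide : Carrier → List Fun → List Fun
  divide s []       = []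
  divide s (a ∷ as) = eval (a ∷ as) s ∷ divide s as

  length-divide : ∀ s as → length (divide s as) ≡ length as
  length-divide s []       = refl
  length-divide s (a ∷ as) = cong suc (length-divide s as)

  divide-eval : ∀ s t as x → t * eval as t x + - (s * eval as s x) ≡ (t + - s) * eval (divide s as) t x
  divide-eval s t []       x = solve 2 (λ t s → t :* con 0ℤ :- s :* con 0ℤ := (t :- s) :* con 0ℤ) refl t s
  divide-eval s t (a ∷ as) x = begin
    t * (a x + t * Pₜ) + - (s * (a x + s * Pₛ))
      ≡⟨ solve 5 (λ a t s Pₜ Pₛ → t :* (a :+ t :* Pₜ) :- s :* (a :+ s :* Pₛ)
                                   := (t :- s) :* (a :+ s :* Pₛ) :+ t :* (t :* Pₜ :- s :* Pₛ)) refl (a x) t s Pₜ Pₛ ⟩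
    (t + - s) * (a x + s * Pₛ) + t * (t * Pₜ + - (s * Pₛ))
      ≡⟨ cong (λ z → (t + - s) * (a x + s * Pₛ) + t * z) (divide-eval s t as x) ⟩
    (t + - s) * (a x + s * Pₛ) + t * ((t + - s) * Qₜ)
      ≡⟨ solve 5 (λ t s a Pₛ Qₜ → (t :- s) :* (a :+ s :* Pₛ) :+ t :* ((t :- s) :* Qₜ)
                                   := (t :- s) :* ((a :+ s :* Pₛ) :+ t :* Qₜ)) refl t s (a x) Pₛ Qₜ ⟩
    (t + - s) * ((a x + s * Pₛ) + t * Qₜ)
      ∎
    where
    Pₜ = eval as t x
    Pₛ = eval as s x
    Qₜ = eval (divide s as) t x

  module _ {W : Fun → Set} (W-subspace : IsSubspace W) where

    open IsSubspace W-subspace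

    eval∈ : ∀ {as} → All W as → ∀ t → W (eval as t)
    eval∈ []          t = zero∈
    eval∈ (a∈ ∷ as∈) t = add∈ _ _ a∈ (scale∈ t _ (eval∈ as∈ t))

    head∈ : ∀ {a as} s → W (eval (a ∷ as) s) → All W as → W a
    head∈ {a} {as} s P∈ as∈ = resp _ a a≡ (add∈ _ _ P∈ (scale∈ (- s) _ (eval∈ as∈ s)))
      where
      a≡ : ∀ x → InG x → (a x + s * eval as s x) + - s * eval as s x ≡ a x
      a≡ x _ = solve 3 (λ a s e → (a :+ s :* e) :+ (:- s) :* e := a) refl (a x) s (eval as s x)

    undivide : ∀ s {as} → All W (divide s as) → All W as
    undivide s {[]}     []         = []
    undivide s {a ∷ as} (P∈ ∷ Q∈) = head∈ s P∈ as∈ ∷ as∈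
      where
      as∈ : All W as
      as∈ = undivide s Q∈

    -- Induction on the points: the difference quotient at the first point takes values in W at the others.
    coefficients∈ : ∀ as ts → Unique ts → length as ≤ length ts → (∀ t → t ∈ ts → W (eval as t)) → All W as
    coefficients∈ []       _        _                _         _  = []
    coefficients∈ (a ∷ as) (s ∷ ts) (s∉ts ∷ ts-unique) (s≤s |as|≤|ts|) P∈ = head∈ s (P∈ s (here refl)) as∈ ∷ as∈
      where
      Q∈ : ∀ t → t ∈ ts → W (eval (divide s as) t)
      Q∈ t t∈ts =
        resp _ _ Q≡ (scale∈ ((t + - s) ⁻¹) _ (add∈ _ _ (P∈ t (there t∈ts)) (scale∈ (- 1#) _ (P∈ s (here refl)))))
        where
        t-s≢0 : t + - s ≢ 0#
        t-s≢0 = All.lookup s∉ts t∈ts ∘ sym ∘ x-y≡0⇒x≡y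
        Q≡ : ∀ x → InG x → (t + - s) ⁻¹ * (eval (a ∷ as) t x + - 1# * eval (a ∷ as) s x) ≡ eval (divide s as) t x
        Q≡ x _ = begin
          (t + - s) ⁻¹ * ((a x + t * eval as t x) + - 1# * (a x + s * eval as s x))
            ≡⟨ cong ((t + - s) ⁻¹ *_)
                    (solve 5 (λ a t s Pₜ Pₛ → (a :+ t :* Pₜ) :+ (:- con 1ℤ) :* (a :+ s :* Pₛ) := t :* Pₜ :- s :* Pₛ)
                             refl (a x) t s (eval as t x) (eval as s x)) ⟩
          (t + - s) ⁻¹ * (t * eval as t x + - (s * eval as s x))
            ≡⟨ cong ((t + - s) ⁻¹ *_) (divide-eval s t as x) ⟩
          (t + - s) ⁻¹ * ((t + - s) * eval (divide s as) t x)
            ≡⟨ ⁻¹-cancelˡ _ t-s≢0 ⟩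
          eval (divide s as) t x
            ∎
      as∈ : All W as
      as∈ = undivide s (coefficients∈ (divide s as) ts ts-unique |Q|≤|ts| Q∈)
        where
        |Q|≤|ts| : length (divide s as) ≤ length ts
        |Q|≤|ts| = subst (_≤ length ts) (sym (length-divide s as)) |as|≤|ts|

  eval-applyUpTo : ∀ n (A : ℕ → Fun) t x → eval (applyUpTo A n) t x ≡ sumBelow n (λ m → t ^ m * A m x)
  eval-applyUpTo zero    A t x = refl
  eval-applyUpTo (suc n) A t x = begin
    A 0 x + t * eval (applyUpTo (A ∘ suc) n) t x
      ≡⟨ cong (λ z → A 0 x + t * z) (eval-applyUpTo n (A ∘ suc) t x) ⟩
    A 0 x + t * sumBelow n (λ m → t ^ m * A (suc m) x)
      ≡⟨ cong₂ _+_ (sym (*-identityˡ _)) (*-distribˡ-sumBelow n t _) ⟩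
    1# * A 0 x + sumBelow n (λ m → t * (t ^ m * A (suc m) x))
      ≡⟨ cong (1# * A 0 x +_) (sumBelow-cong n (λ m _ → sym (*-assoc _ _ _))) ⟩
    1# * A 0 x + sumBelow n (λ m → t ^ suc m * A (suc m) x)
      ≡⟨ sym (sumBelow-suc n _) ⟩
    sumBelow (suc n) (λ m → t ^ m * A m x)
      ∎

module Interpolation (F : Field) (p : ℕ) (p-prime : Prime p) (char-p : Rep.natF F p p ≡ Field.0# F)
                     (Fq : List (Field.Carrier F)) (Fq-unique : Unique Fq)
                     (Fq⊆𝔽q : ∀ x → x ∈ Fq → Rep.InFq F p x) (𝔽q⊆Fq : ∀ x → Rep.InFq F p x → x ∈ Fq) where

  open PrimeCharacteristic F p p-prime char-p
  open ≡-Reasoning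

  indicator : Carrier → Carrier → Carrier
  indicator s w = 1# + - ((w + - s) ^ (q ∸ 1))

  indicatorCoeff : Carrier → ℕ → Carrier
  indicatorCoeff s j = δ 0 j + - (choose (q ∸ 1) j * (- s) ^ (q ∸ 1 ∸ j))

  indicator-expansion : ∀ w s → indicator s w ≡ sumBelow q (λ j → indicatorCoeff s j * w ^ j)
  indicator-expansion w s = begin
    1# + - ((w + - s) ^ (q ∸ 1))
      ≡⟨ cong₂ (λ a b → a + - b) (sym (sumBelow-δ (w ^_) 0<q)) (lucas q∸1<q w (- s)) ⟩
    sumBelow q (λ j → δ 0 j * w ^ j) + - sumBelow q t
      ≡⟨ cong (sumBelow q (λ j → δ 0 j * w ^ j) +_) (-‿sumBelow q t) ⟩
    sumBelow q (λ j → δ 0 j * w ^ j) + sumBelow q (λ j → - t j)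
      ≡⟨ sym (sumBelow-distrib-+ q _ _) ⟩
    sumBelow q (λ j → δ 0 j * w ^ j + - t j)
      ≡⟨ sumBelow-cong q (λ j _ → solve 4 (λ d c w y → d :* w :- c :* (w :* y) := (d :- c :* y) :* w)
                                           refl (δ 0 j) (choose (q ∸ 1) j) (w ^ j) ((- s) ^ (q ∸ 1 ∸ j))) ⟩
    sumBelow q (λ j → indicatorCoeff s j * w ^ j)
      ∎
    where
    q∸1<q : q ∸ 1 < q
    q∸1<q = subst (q ∸ 1 <_) (sym q≡1+[q∸1]) (ℕ.n<1+n _)
    t : ℕ → Carrier
    t j = choose (q ∸ 1) j * (w ^ j * (- s) ^ (q ∸ 1 ∸ j))

  indicator-diag : ∀ w → indicator w w ≡ 1#
  indicator-diag w = begin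
    1# + - ((w + - w) ^ (q ∸ 1))   ≡⟨ cong (λ z → 1# + - (z ^ (q ∸ 1))) (-‿inverseʳ w) ⟩
    1# + - (0# ^ (q ∸ 1))          ≡⟨ cong (λ z → 1# + - z) (0^n≡0 (ℕ.>⇒≢ (ℕ.∸-monoˡ-< 1<q ℕ.≤-refl))) ⟩
    1# + - 0#                      ≡⟨ trans (cong (1# +_) -0#≈0#) (+-identityʳ 1#) ⟩
    1#                             ∎

  indicator-off : ∀ {w s} → InFq w → InFq s → w ≢ s → indicator s w ≡ 0#
  indicator-off {w} {s} wᵠ sᵠ w≢s = begin
    1# + - ((w + - s) ^ (q ∸ 1))   ≡⟨ cong (λ z → 1# + - z) (fermat (InFq-+ wᵠ (InFq-- sᵠ)) (w≢s ∘ x-y≡0⇒x≡y)) ⟩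
    1# + - 1#                      ≡⟨ -‿inverseʳ 1# ⟩
    0#                             ∎

  interpolationCoeff : (Carrier → Carrier) → ℕ → Carrier
  interpolationCoeff φ j = sumF (map (λ s → φ s * indicatorCoeff s j) Fq)

  interpolation : ∀ φ {w} → InFq w → φ w ≡ sumBelow q (λ j → interpolationCoeff φ j * w ^ j)
  interpolation φ {w} wᵠ = begin
    φ w
      ≡⟨ sym (trans (cong (φ w *_) (indicator-diag w)) (*-identityʳ _)) ⟩
    φ w * indicator w w
      ≡⟨ sym (sumF-single (λ s → φ s * indicator s w) w Fq-unique (𝔽q⊆Fq w wᵠ) off≡0) ⟩
    sumF (map (λ s → φ s * indicator s w) Fq)
      ≡⟨ cong sumF (map-cong (λ s → trans (cong (φ s *_) (indicator-expansion w s)) (*-distribˡ-sumBelow q (φ s) _)) Fq) ⟩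
    sumF (map (λ s → sumBelow q (λ j → φ s * (indicatorCoeff s j * w ^ j))) Fq)
      ≡⟨ sumF-sumBelow Fq q _ ⟩
    sumBelow q (λ j → sumF (map (λ s → φ s * (indicatorCoeff s j * w ^ j)) Fq))
      ≡⟨ sumBelow-cong q (λ j _ → trans (cong sumF (map-cong (λ s → sym (*-assoc _ _ _)) Fq))
                                        (sym (*-distribʳ-sumF Fq _ (w ^ j)))) ⟩
    sumBelow q (λ j → interpolationCoeff φ j * w ^ j)
      ∎
    where
    off≡0 : ∀ s → s ∈ Fq → s ≢ w → φ s * indicator s w ≡ 0#
    off≡0 s s∈Fq s≢w = trans (cong (φ s *_) (indicator-off wᵠ (Fq⊆𝔽q s s∈Fq) (s≢w ∘ sym))) (zeroʳ _)

module InducedRepresentation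
  (F : Field) (p : ℕ) (p-prime : Prime p) (char-p : Rep.natF F p p ≡ Field.0# F)
  (Fq : List (Field.Carrier F)) (Fq-unique : Unique Fq) (|Fq|≡q : length Fq ≡ Rep.q F p)
  (Fq⊆𝔽q : ∀ x → x ∈ Fq → Rep.InFq F p x) (𝔽q⊆Fq : ∀ x → Rep.InFq F p x → x ∈ Fq)
  (χ : Rep.Pt F p → Field.Carrier F) (χ-character : Rep.IsCharacter F p χ)
  (v : Field.Carrier F) (v≢0 : v ≢ Field.0# F) where

  open PrimeCharacteristic F p p-prime char-p
  open Vandermonde F p
  open Interpolation F p p-prime char-p Fq Fq-unique Fq⊆𝔽q 𝔽q⊆Fq
  open ≡-Reasoning

  χ≢0 : ∀ {g} → InG g → χ g ≢ 0#
  χ≢0 = proj₁ χ-character _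

  χ-mul : ∀ {g h} → InG g → InG h → χ (mul g h) ≡ χ g * χ h
  χ-mul = proj₂ χ-character _ _

  InG-mul : ∀ {x g} → InG x → InG g → InG (mul x g)
  InG-mul {a , b} {a′ , b′} (aᵠ , a≢0 , bᵠ) (a′ᵠ , a′≢0 , b′ᵠ) =
    InFq-* aᵠ a′ᵠ , *≢0 a≢0 a′≢0 , InFq-+ (InFq-* (InFq-^ p aᵠ) b′ᵠ) (InFq-* bᵠ a′ᵠ)

  InH⇒InG : ∀ {h} → InH h → InG h
  InH⇒InG (aᵠ , a≢0 , refl) = aᵠ , a≢0 , InFq-0

  InG-1 : InG (1# , 0#)
  InG-1 = InFq-1 , 1≢0 , InFq-0

  mul-diag : ∀ a a′ → mul (a , 0#) (a′ , 0#) ≡ (a * a′ , 0#)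
  mul-diag a a′ = cong (a * a′ ,_) (solve 2 (λ A a′ → A :* con 0ℤ :+ con 0ℤ :* a′ := con 0ℤ) refl (a ^ p) a′)

  χ-diag : ∀ {a a′} → InFq a → a ≢ 0# → InFq a′ → a′ ≢ 0# → χ (a * a′ , 0#) ≡ χ (a , 0#) * χ (a′ , 0#)
  χ-diag {a} {a′} aᵠ a≢0 a′ᵠ a′≢0 =
    trans (cong χ (sym (mul-diag a a′))) (χ-mul (aᵠ , a≢0 , InFq-0) (a′ᵠ , a′≢0 , InFq-0))

  χ-1 : χ (1# , 0#) ≡ 1#
  χ-1 = sym (*-cancelˡ 1# χ₁ (χ≢0 InG-1) (begin
    χ₁ * 1#                    ≡⟨ *-identityʳ χ₁ ⟩
    χ (1# , 0#)                ≡⟨ cong χ (sym (trans (mul-diag 1# 1#) (cong (_, 0#) (*-identityˡ 1#)))) ⟩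
    χ (mul (1# , 0#) (1# , 0#)) ≡⟨ χ-mul InG-1 InG-1 ⟩
    χ₁ * χ₁                    ∎))
    where
    χ₁ : Carrier
    χ₁ = χ (1# , 0#)

  -- λ = u x is the only λ with x (1 + ϖ[λ]) ∈ U_D² H, so f_{k,v} is the monomial u^k ψ.
  u : Pt → Carrier
  u (a , b) = - (b * (a ^ p) ⁻¹)

  ψ : Pt → Carrier
  ψ (a , b) = χ (a , 0#) * v

  uᵠ : ∀ {x} → InG x → InFq (u x)
  uᵠ {a , b} (aᵠ , a≢0 , bᵠ) = InFq-- (InFq-* bᵠ (InFq-⁻¹ (InFq-^ p aᵠ) (^≢0 p a≢0)))

  affine-root : ∀ {A} b → A ≢ 0# → A * - (b * A ⁻¹) + b * 1# ≡ 0#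
  affine-root {A} b A≢0 = begin
    A * - (b * A ⁻¹) + b * 1#
      ≡⟨ solve 3 (λ A b A⁻¹ → A :* (:- (b :* A⁻¹)) :+ b :* con 1ℤ := b :- b :* (A :* A⁻¹)) refl A b (A ⁻¹) ⟩
    b + - (b * (A * A ⁻¹))
      ≡⟨ cong (λ z → b + - (b * z)) (⁻¹-inverse A A≢0) ⟩
    b + - (b * 1#)
      ≡⟨ solve 1 (λ b → b :- b :* con 1ℤ := con 0ℤ) refl b ⟩
    0#
      ∎

  affine-root-unique : ∀ {A} b l → A ≢ 0# → A * l + b * 1# ≡ 0# → l ≡ - (b * A ⁻¹)
  affine-root-unique {A} b l A≢0 root =
    *-cancelˡ l _ A≢0 (+-cancelʳ (b * 1#) _ _ (trans root (sym (affine-root b A≢0))))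

  bracket-root : ∀ g x → proj₂ (mul x g) ≡ 0# → bracket χ g v x ≡ χ (mul x g) * v
  bracket-root g x root with proj₂ (mul x g) ≟ 0#
  ... | yes _    = refl
  ... | no ¬root = ⊥-elim (¬root root)

  bracket-¬root : ∀ g x → proj₂ (mul x g) ≢ 0# → bracket χ g v x ≡ 0#
  bracket-¬root g x ¬root with proj₂ (mul x g) ≟ 0#
  ... | yes root = ⊥-elim (¬root root)
  ... | no _     = refl

  fkv-closed-form : ∀ k {x} → InG x → fkv Fq χ k v x ≡ u x ^ k * ψ x
  fkv-closed-form k {a , b} x∈G@(_ , a≢0 , _) =
    trans (sumF-single term (u (a , b)) Fq-unique (𝔽q⊆Fq _ (uᵠ x∈G)) off≡0) on-root
    where
    aᵖ≢0 : a ^ p ≢ 0#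
    aᵖ≢0 = ^≢0 p a≢0
    term : Carrier → Carrier
    term l = l ^ k * bracket χ (1# , l) v (a , b)
    off≡0 : ∀ l → l ∈ Fq → l ≢ u (a , b) → term l ≡ 0#
    off≡0 l _ l≢u =
      trans (cong (l ^ k *_) (bracket-¬root (1# , l) (a , b) (l≢u ∘ affine-root-unique b l aᵖ≢0))) (zeroʳ _)
    on-root : term (u (a , b)) ≡ u (a , b) ^ k * ψ (a , b)
    on-root = cong (u (a , b) ^ k *_) (trans (bracket-root (1# , u (a , b)) (a , b) (affine-root b aᵖ≢0))
                                             (cong (λ y → χ y * v) (cong₂ _,_ (*-identityʳ a) (affine-root b aᵖ≢0))))

  [aa′]ᵖ⁻¹ : ∀ {a a′} → a ≢ 0# → a′ ≢ 0# → ((a * a′) ^ p) ⁻¹ ≡ (a ^ p) ⁻¹ * (a′ ^ p) ⁻¹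
  [aa′]ᵖ⁻¹ {a} {a′} a≢0 a′≢0 = trans (cong _⁻¹ (^-distrib-* a a′ p)) (⁻¹-distrib-* (^≢0 p a≢0) (^≢0 p a′≢0))

  u-left : ∀ {h x} → InH h → InG x → u (mul h x) ≡ u x
  u-left {c , _} {a , b} (_ , c≢0 , refl) (_ , a≢0 , _) = cong -_ (begin
    (cᵖ * b + 0# * a) * ((c * a) ^ p) ⁻¹
      ≡⟨ cong ((cᵖ * b + 0# * a) *_) ([aa′]ᵖ⁻¹ c≢0 a≢0) ⟩
    (cᵖ * b + 0# * a) * (cᵖ ⁻¹ * aᵖ ⁻¹)
      ≡⟨ solve 5 (λ C b a C⁻¹ A⁻¹ → (C :* b :+ con 0ℤ :* a) :* (C⁻¹ :* A⁻¹) := (C :* C⁻¹) :* (b :* A⁻¹)) refl cᵖ b a _ _ ⟩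
    (cᵖ * cᵖ ⁻¹) * (b * aᵖ ⁻¹)
      ≡⟨ cong (_* (b * aᵖ ⁻¹)) (⁻¹-inverse cᵖ (^≢0 p c≢0)) ⟩
    1# * (b * aᵖ ⁻¹)
      ≡⟨ *-identityˡ _ ⟩
    b * aᵖ ⁻¹
      ∎)
    where
    cᵖ = c ^ p
    aᵖ = a ^ p

  ψ-left : ∀ {h x} → InH h → InG x → ψ (mul h x) ≡ χ h * ψ x
  ψ-left {c , _} {a , _} (cᵠ , c≢0 , refl) (aᵠ , a≢0 , _) = trans (cong (_* v) (χ-diag cᵠ c≢0 aᵠ a≢0)) (*-assoc _ _ _)

  μ : Pt → Carrier
  μ (a , _) = a * (a ^ p) ⁻¹

  u-right : ∀ {x g} → InG x → InG g → u (mul x g) ≡ μ g * u x + u g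
  u-right {a , b} {a′ , b′} (_ , a≢0 , _) (_ , a′≢0 , _) = begin
    - ((aᵖ * b′ + b * a′) * ((a * a′) ^ p) ⁻¹)
      ≡⟨ cong (λ z → - ((aᵖ * b′ + b * a′) * z)) ([aa′]ᵖ⁻¹ a≢0 a′≢0) ⟩
    - ((aᵖ * b′ + b * a′) * (aᵖ ⁻¹ * a′ᵖ ⁻¹))
      ≡⟨ solve 6 (λ A b′ b a′ A⁻¹ A′⁻¹ → :- ((A :* b′ :+ b :* a′) :* (A⁻¹ :* A′⁻¹))
                                         := (a′ :* A′⁻¹) :* (:- (b :* A⁻¹)) :- (A :* A⁻¹) :* (b′ :* A′⁻¹))
               refl aᵖ b′ b a′ (aᵖ ⁻¹) (a′ᵖ ⁻¹) ⟩
    μ (a′ , b′) * u (a , b) + - ((aᵖ * aᵖ ⁻¹) * (b′ * a′ᵖ ⁻¹))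
      ≡⟨ cong (λ z → μ (a′ , b′) * u (a , b) + - (z * (b′ * a′ᵖ ⁻¹))) (⁻¹-inverse aᵖ (^≢0 p a≢0)) ⟩
    μ (a′ , b′) * u (a , b) + - (1# * (b′ * a′ᵖ ⁻¹))
      ≡⟨ cong (λ z → μ (a′ , b′) * u (a , b) + - z) (*-identityˡ _) ⟩
    μ (a′ , b′) * u (a , b) + u (a′ , b′)
      ∎
    where
    aᵖ = a ^ p
    a′ᵖ = a′ ^ p

  ψ-right : ∀ {x g} → InG x → InG g → ψ (mul x g) ≡ χ (proj₁ g , 0#) * ψ x
  ψ-right {a , _} {a′ , _} (aᵠ , a≢0 , _) (a′ᵠ , a′≢0 , _) = begin
    χ (a * a′ , 0#) * v                 ≡⟨ cong (_* v) (χ-diag aᵠ a≢0 a′ᵠ a′≢0) ⟩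
    (χ (a , 0#) * χ (a′ , 0#)) * v      ≡⟨ xy∙z≈y∙xz (χ (a , 0#)) (χ (a′ , 0#)) v ⟩
    χ (a′ , 0#) * (χ (a , 0#) * v)      ∎

  f : ℕ → Fun
  f k = fkv Fq χ k v

  combination : (ℕ → Carrier) → Fun
  combination c x = sumBelow q (λ j → c j * f j x)

  ≈G-isInd : ∀ {g h} → h ≈G g → IsInd χ g → IsInd χ h
  ≈G-isInd h≈g g-isInd c x c∈H x∈G = begin
    _   ≡⟨ h≈g _ (InG-mul (InH⇒InG c∈H) x∈G) ⟩
    _   ≡⟨ g-isInd c x c∈H x∈G ⟩
    _   ≡⟨ cong (χ c *_) (sym (h≈g x x∈G)) ⟩
    _   ∎

  f-isInd : ∀ k → IsInd χ (f k)
  f-isInd k c x c∈H x∈G = begin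
    f k (mul c x)                   ≡⟨ fkv-closed-form k (InG-mul (InH⇒InG c∈H) x∈G) ⟩
    u (mul c x) ^ k * ψ (mul c x)   ≡⟨ cong₂ (λ w y → w ^ k * y) (u-left c∈H x∈G) (ψ-left c∈H x∈G) ⟩
    u x ^ k * (χ c * ψ x)           ≡⟨ x∙yz≈y∙xz (u x ^ k) (χ c) (ψ x) ⟩
    χ c * (u x ^ k * ψ x)           ≡⟨ cong (χ c *_) (sym (fkv-closed-form k x∈G)) ⟩
    χ c * f k x                     ∎

  combination-isInd : ∀ c → IsInd χ (combination c)
  combination-isInd c h x h∈H x∈G = begin
    sumBelow q (λ j → c j * f j (mul h x))  ≡⟨ sumBelow-cong q (λ j _ → cong (c j *_) (f-isInd j h x h∈H x∈G)) ⟩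
    sumBelow q (λ j → c j * (χ h * f j x))  ≡⟨ sumBelow-cong q (λ j _ → x∙yz≈y∙xz (c j) (χ h) (f j x)) ⟩
    sumBelow q (λ j → χ h * (c j * f j x))  ≡⟨ sym (*-distribˡ-sumBelow q (χ h) _) ⟩
    χ h * combination c x                   ∎

  f-right : ∀ k {x g} → InG x → InG g → f k (mul x g) ≡ χ (proj₁ g , 0#) * ((μ g * u x + u g) ^ k * ψ x)
  f-right k {x} {g} x∈G g∈G = begin
    f k (mul x g)                                  ≡⟨ fkv-closed-form k (InG-mul x∈G g∈G) ⟩
    u (mul x g) ^ k * ψ (mul x g)                  ≡⟨ cong₂ (λ w y → w ^ k * y) (u-right x∈G g∈G) (ψ-right x∈G g∈G) ⟩
    (μ g * u x + u g) ^ k * (χg * ψ x)             ≡⟨ x∙yz≈y∙xz _ χg (ψ x) ⟩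
    χg * ((μ g * u x + u g) ^ k * ψ x)             ∎
    where
    χg = χ (proj₁ g , 0#)

  affineCoeff : Carrier → Carrier → ℕ → ℕ → Carrier
  affineCoeff α β i j = choose i j * (α ^ j * β ^ (i ∸ j))

  affineCoeff-⋠ : ∀ α β {i j} → ¬ j ≼ i → affineCoeff α β i j ≡ 0#
  affineCoeff-⋠ α β {i} {j} j⋠i = trans (cong (_* (α ^ j * β ^ (i ∸ j))) (choose-⋠ j⋠i)) (zeroˡ _)

  affine-expansion : ∀ {i} → i < q → ∀ α β {x} → InG x →
                     (α * u x + β) ^ i * ψ x ≡ sumBelow q (λ j → affineCoeff α β i j * f j x)
  affine-expansion {i} i<q α β {x} x∈G = begin
    (α * u x + β) ^ i * ψ x
      ≡⟨ cong (_* ψ x) (lucas i<q (α * u x) β) ⟩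
    sumBelow q (λ j → choose i j * ((α * u x) ^ j * β ^ (i ∸ j))) * ψ x
      ≡⟨ *-distribʳ-sumBelow q (ψ x) _ ⟩
    sumBelow q (λ j → choose i j * ((α * u x) ^ j * β ^ (i ∸ j)) * ψ x)
      ≡⟨ sumBelow-cong q (λ j _ → term j) ⟩
    sumBelow q (λ j → affineCoeff α β i j * f j x)
      ∎
    where
    term : ∀ j → choose i j * ((α * u x) ^ j * β ^ (i ∸ j)) * ψ x ≡ affineCoeff α β i j * f j x
    term j = begin
      choose i j * ((α * u x) ^ j * β ^ (i ∸ j)) * ψ x
        ≡⟨ cong (λ z → choose i j * (z * β ^ (i ∸ j)) * ψ x) (^-distrib-* α (u x) j) ⟩
      choose i j * ((α ^ j * u x ^ j) * β ^ (i ∸ j)) * ψ x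
        ≡⟨ solve 5 (λ e a w b y → e :* ((a :* w) :* b) :* y := (e :* (a :* b)) :* (w :* y))
                 refl (choose i j) (α ^ j) (u x ^ j) (β ^ (i ∸ j)) (ψ x) ⟩
      affineCoeff α β i j * (u x ^ j * ψ x)
        ≡⟨ cong (affineCoeff α β i j *_) (sym (fkv-closed-form j x∈G)) ⟩
      affineCoeff α β i j * f j x
        ∎

  actCoeff : Pt → ℕ → ℕ → Carrier
  actCoeff g i j = χ (proj₁ g , 0#) * affineCoeff (μ g) (u g) i j

  actCombination : (ℕ → Carrier) → Pt → ℕ → Carrier
  actCombination c g j = sumBelow q (λ i → c i * actCoeff g i j)

  act-combination : ∀ c {g} → InG g → act g (combination c) ≈G combination (actCombination c g)
  act-combination c {g} g∈G x x∈G = begin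
    sumBelow q (λ i → c i * f i (mul x g))
      ≡⟨ sumBelow-cong q (λ i i<q → expand i i<q) ⟩
    sumBelow q (λ i → sumBelow q (λ j → (c i * actCoeff g i j) * f j x))
      ≡⟨ sumBelow-comm q q _ ⟩
    sumBelow q (λ j → sumBelow q (λ i → (c i * actCoeff g i j) * f j x))
      ≡⟨ sumBelow-cong q (λ j _ → sym (*-distribʳ-sumBelow q (f j x) _)) ⟩
    combination (actCombination c g) x
      ∎
    where
    χg = χ (proj₁ g , 0#)
    e : ℕ → ℕ → Carrier
    e = affineCoeff (μ g) (u g)
    expand : ∀ i → i < q → c i * f i (mul x g) ≡ sumBelow q (λ j → (c i * actCoeff g i j) * f j x)
    expand i i<q = begin
      c i * f i (mul x g)                              ≡⟨ cong (c i *_) (f-right i x∈G g∈G) ⟩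
      c i * (χg * ((μ g * u x + u g) ^ i * ψ x))       ≡⟨ cong (λ z → c i * (χg * z)) (affine-expansion i<q (μ g) (u g) x∈G) ⟩
      c i * (χg * sumBelow q (λ j → e i j * f j x))    ≡⟨ cong (c i *_) (*-distribˡ-sumBelow q χg _) ⟩
      c i * sumBelow q (λ j → χg * (e i j * f j x))    ≡⟨ *-distribˡ-sumBelow q (c i) _ ⟩
      sumBelow q (λ j → c i * (χg * (e i j * f j x)))  ≡⟨ sumBelow-cong q (λ j _ → reassociate (c i) χg (e i j) (f j x)) ⟩
      sumBelow q (λ j → (c i * actCoeff g i j) * f j x) ∎
      where
      reassociate : ∀ a b c d → a * (b * (c * d)) ≡ (a * (b * c)) * d
      reassociate = solve 4 (λ a b c d → a :* (b :* (c :* d)) := (a :* (b :* c)) :* d) refl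

  actCombination-≼ : ∀ c g {k} → (∀ i → ¬ i ≼ k → c i ≡ 0#) → ∀ {j} → ¬ j ≼ k → actCombination c g j ≡ 0#
  actCombination-≼ c g {k} c-≼ {j} j⋠k = sumBelow-zero q term≡0
    where
    term≡0 : ∀ i → i < q → c i * actCoeff g i j ≡ 0#
    term≡0 i _ with i ≼? k
    ... | yes i≼k = trans (cong (λ z → c i * (χ (proj₁ g , 0#) * z)) (affineCoeff-⋠ (μ g) (u g) (j⋠k ∘ flip ≼-trans i≼k)))
                          (trans (cong (c i *_) (zeroʳ _)) (zeroʳ (c i)))
    ... | no  i⋠k = trans (cong (_* actCoeff g i j) (c-≼ i i⋠k)) (zeroˡ _)

  combination-+ : ∀ c c′ x → combination (λ j → c j + c′ j) x ≡ combination c x + combination c′ x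
  combination-+ c c′ x = trans (sumBelow-cong q (λ j _ → distribʳ (f j x) (c j) (c′ j))) (sumBelow-distrib-+ q _ _)

  combination-* : ∀ a c x → combination (λ j → a * c j) x ≡ a * combination c x
  combination-* a c x = trans (sumBelow-cong q (λ j _ → *-assoc a (c j) (f j x))) (sym (*-distribˡ-sumBelow q a _))

  combination-δ : ∀ {k} → k < q → ∀ x → combination (δ k) x ≡ f k x
  combination-δ k<q x = sumBelow-δ (λ j → f j x) k<q

  span-isSubrep : ∀ {k} → k < q → IsSubrep χ (SpanPrec Fq χ v k)
  span-isSubrep {k} k<q = record
    { ⊆Ind   = λ { h (c , _ , h≈c) → ≈G-isInd h≈c (combination-isInd c) }
    ; resp   = λ { h h′ h≈h′ (c , c-supp , h≈c) → c , c-supp , λ x x∈G → trans (sym (h≈h′ x x∈G)) (h≈c x x∈G) }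
    ; zero∈  = (λ _ → 0#) , (λ _ _ → refl) , λ x _ → sym (sumBelow-zero q (λ j _ → zeroˡ (f j x)))
    ; add∈   = λ { h h′ (c , c-supp , h≈c) (c′ , c′-supp , h′≈c′) →
                 (λ j → c j + c′ j) ,
                 (λ j j⋠k → trans (cong₂ _+_ (c-supp j j⋠k) (c′-supp j j⋠k)) (+-identityˡ 0#)) ,
                 λ x x∈G → trans (cong₂ _+_ (h≈c x x∈G) (h′≈c′ x x∈G)) (sym (combination-+ c c′ x)) }
    ; scale∈ = λ { a h (c , c-supp , h≈c) →
                 (λ j → a * c j) ,
                 (λ j j⋠k → trans (cong (a *_) (c-supp j j⋠k)) (zeroʳ a)) ,
                 λ x x∈G → trans (cong (a *_) (h≈c x x∈G)) (sym (combination-* a c x)) }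
    ; act∈   = λ { g h g∈G (c , c-supp , h≈c) →
                 actCombination c g ,
                 (λ j ¬j⪯k → actCombination-≼ c g (λ i i⋠k → c-supp i (i⋠k ∘ Preceq⇒≼)) (¬j⪯k ∘ ≼⇒Preceq k<q)) ,
                 λ x x∈G → trans (h≈c (mul x g) (InG-mul x∈G g∈G)) (act-combination c g∈G x x∈G) }
    }

  f∈span : ∀ {k} → k < q → SpanPrec Fq χ v k (f k)
  f∈span {k} k<q =
    δ k , (λ j ¬j⪯k → δ-off {k} {j} λ { refl → ¬j⪯k (≼⇒Preceq k<q ≼-refl) }) , λ x _ → sym (combination-δ k<q x)

  translation : Carrier → Pt
  translation t = (1# , - t)

  translation∈G : ∀ {t} → InFq t → InG (translation t)
  translation∈G tᵠ = InFq-1 , 1≢0 , InFq-- tᵠ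

  f-translation : ∀ k {t x} → InFq t → InG x → f k (mul x (translation t)) ≡ (t + u x) ^ k * ψ x
  f-translation k {t} {x} tᵠ x∈G = begin
    f k (mul x (translation t))                                  ≡⟨ f-right k x∈G (translation∈G tᵠ) ⟩
    χ (1# , 0#) * ((μ (1# , - t) * u x + u (1# , - t)) ^ k * ψ x) ≡⟨ cong₂ (λ c w → c * (w ^ k * ψ x)) χ-1 base ⟩
    1# * ((t + u x) ^ k * ψ x)                                   ≡⟨ *-identityˡ _ ⟩
    (t + u x) ^ k * ψ x                                          ∎
    where
    1ᵖ⁻¹≡1 : (1# ^ p) ⁻¹ ≡ 1#
    1ᵖ⁻¹≡1 = trans (cong _⁻¹ (1^n≡1 p)) 1⁻¹≡1
    base : μ (1# , - t) * u x + u (1# , - t) ≡ t + u x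
    base = begin
      (1# * (1# ^ p) ⁻¹) * u x + - (- t * (1# ^ p) ⁻¹)
        ≡⟨ cong (λ z → (1# * z) * u x + - (- t * z)) 1ᵖ⁻¹≡1 ⟩
      (1# * 1#) * u x + - (- t * 1#)
        ≡⟨ solve 2 (λ t w → (con 1ℤ :* con 1ℤ) :* w :+ :- ((:- t) :* con 1ℤ) := t :+ w) refl t (u x) ⟩
      t + u x
        ∎

  translationCoeff : (ℕ → Carrier) → ℕ → Fun
  translationCoeff c m x = sumBelow q (λ j → (c j * choose j m) * f (j ∸ m) x)

  act-translation : ∀ c {t x} → InFq t → InG x →
                    act (translation t) (combination c) x ≡ sumBelow q (λ m → t ^ m * translationCoeff c m x)
  act-translation c {t} {x} tᵠ x∈G = begin
    sumBelow q (λ j → c j * f j (mul x (translation t)))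
      ≡⟨ sumBelow-cong q (λ j j<q → cong (c j *_) (trans (f-translation j tᵠ x∈G)
                                                         (cong (_* ψ x) (lucas j<q t (u x))))) ⟩
    sumBelow q (λ j → c j * (sumBelow q (λ m → choose j m * (t ^ m * u x ^ (j ∸ m))) * ψ x))
      ≡⟨ sumBelow-cong q (λ j _ → expand j) ⟩
    sumBelow q (λ j → sumBelow q (λ m → t ^ m * ((c j * choose j m) * f (j ∸ m) x)))
      ≡⟨ sumBelow-comm q q _ ⟩
    sumBelow q (λ m → sumBelow q (λ j → t ^ m * ((c j * choose j m) * f (j ∸ m) x)))
      ≡⟨ sumBelow-cong q (λ m _ → sym (*-distribˡ-sumBelow q (t ^ m) _)) ⟩
    sumBelow q (λ m → t ^ m * translationCoeff c m x)
      ∎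
    where
    expand : ∀ j → c j * (sumBelow q (λ m → choose j m * (t ^ m * u x ^ (j ∸ m))) * ψ x)
                 ≡ sumBelow q (λ m → t ^ m * ((c j * choose j m) * f (j ∸ m) x))
    expand j = begin
      c j * (sumBelow q (λ m → choose j m * (t ^ m * u x ^ (j ∸ m))) * ψ x)
        ≡⟨ cong (c j *_) (*-distribʳ-sumBelow q (ψ x) _) ⟩
      c j * sumBelow q (λ m → choose j m * (t ^ m * u x ^ (j ∸ m)) * ψ x)
        ≡⟨ *-distribˡ-sumBelow q (c j) _ ⟩
      sumBelow q (λ m → c j * (choose j m * (t ^ m * u x ^ (j ∸ m)) * ψ x))
        ≡⟨ sumBelow-cong q (λ m _ → term m) ⟩
      sumBelow q (λ m → t ^ m * ((c j * choose j m) * f (j ∸ m) x))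
        ∎
      where
      term : ∀ m → c j * (choose j m * (t ^ m * u x ^ (j ∸ m)) * ψ x) ≡ t ^ m * ((c j * choose j m) * f (j ∸ m) x)
      term m = begin
        c j * (choose j m * (t ^ m * u x ^ (j ∸ m)) * ψ x)
          ≡⟨ solve 5 (λ c e tm w y → c :* (e :* (tm :* w) :* y) := tm :* ((c :* e) :* (w :* y)))
                   refl (c j) (choose j m) (t ^ m) (u x ^ (j ∸ m)) (ψ x) ⟩
        t ^ m * ((c j * choose j m) * (u x ^ (j ∸ m) * ψ x))
          ≡⟨ cong (λ z → t ^ m * ((c j * choose j m) * z)) (sym (fkv-closed-form (j ∸ m) x∈G)) ⟩
        t ^ m * ((c j * choose j m) * f (j ∸ m) x)
          ∎

  isInd-section : ∀ {g} → IsInd χ g → ∀ {x} → InG x → g x ≡ χ (proj₁ x , 0#) * g (1# , - u x)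
  isInd-section {g} g-isInd {a , b} (aᵠ , a≢0 , bᵠ) = begin
    g (a , b)                          ≡⟨ cong g (sym (cong₂ _,_ (*-identityʳ a) b≡)) ⟩
    g (mul (a , 0#) (1# , β))          ≡⟨ g-isInd (a , 0#) (1# , β) (aᵠ , a≢0 , refl) (InFq-1 , 1≢0 , βᵠ) ⟩
    χ (a , 0#) * g (1# , β)            ≡⟨ cong (λ z → χ (a , 0#) * g (1# , z)) (sym (-‿involutive β)) ⟩
    χ (a , 0#) * g (1# , - u (a , b))  ∎
    where
    aᵖ≢0 : a ^ p ≢ 0#
    aᵖ≢0 = ^≢0 p a≢0
    β = b * (a ^ p) ⁻¹
    βᵠ : InFq β
    βᵠ = InFq-* bᵠ (InFq-⁻¹ (InFq-^ p aᵠ) aᵖ≢0)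
    b≡ : a ^ p * β + 0# * 1# ≡ b
    b≡ = begin
      a ^ p * (b * (a ^ p) ⁻¹) + 0# * 1#
        ≡⟨ solve 3 (λ A b A⁻¹ → A :* (b :* A⁻¹) :+ con 0ℤ :* con 1ℤ := b :* (A :* A⁻¹)) refl (a ^ p) b ((a ^ p) ⁻¹) ⟩
      b * (a ^ p * (a ^ p) ⁻¹)
        ≡⟨ cong (b *_) (⁻¹-inverse _ aᵖ≢0) ⟩
      b * 1#
        ≡⟨ *-identityʳ b ⟩
      b
        ∎

  spanning : ∀ {g} → IsInd χ g → Σ (ℕ → Carrier) λ c → g ≈G combination c
  spanning {g} g-isInd = c , g≈c
    where
    φ : Carrier → Carrier
    φ w = g (1# , - w)
    e : ℕ → Carrier
    e = interpolationCoeff φ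
    c : ℕ → Carrier
    c j = e j * v ⁻¹
    g≈c : g ≈G combination c
    g≈c x x∈G = begin
      g x                                      ≡⟨ isInd-section g-isInd x∈G ⟩
      χx * φ (u x)                             ≡⟨ cong (χx *_) (interpolation φ (uᵠ x∈G)) ⟩
      χx * sumBelow q (λ j → e j * u x ^ j)    ≡⟨ *-distribˡ-sumBelow q χx _ ⟩
      sumBelow q (λ j → χx * (e j * u x ^ j))  ≡⟨ sumBelow-cong q (λ j _ → term j) ⟩
      combination c x                          ∎
      where
      χx = χ (proj₁ x , 0#)
      term : ∀ j → χx * (e j * u x ^ j) ≡ c j * f j x
      term j = begin
        χx * (e j * u x ^ j)
          ≡⟨ *-comm χx _ ⟩
        (e j * u x ^ j) * χx
          ≡⟨ cong ((e j * u x ^ j) *_) (sym (trans (cong (χx *_) (⁻¹-inverseˡ v≢0)) (*-identityʳ χx))) ⟩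
        (e j * u x ^ j) * (χx * (v ⁻¹ * v))
          ≡⟨ solve 5 (λ e w χ v⁻¹ v → (e :* w) :* (χ :* (v⁻¹ :* v)) := (e :* v⁻¹) :* (w :* (χ :* v))) refl (e j) (u x ^ j) χx (v ⁻¹) v ⟩
        c j * (u x ^ j * ψ x)
          ≡⟨ cong (c j *_) (sym (fkv-closed-form j x∈G)) ⟩
        c j * f j x
          ∎

  module _ {W : Fun → Set} (W-subrep : IsSubrep χ W) where

    open IsSubrep W-subrep

    W-subspace : IsSubspace W
    W-subspace = record { resp = resp ; zero∈ = zero∈ ; add∈ = add∈ ; scale∈ = scale∈ }

    unscale∈ : ∀ {g h} c → c ≢ 0# → W g → (∀ x → InG x → g x ≡ c * h x) → W h
    unscale∈ {g} {h} c c≢0 g∈W g≡ch =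
      resp _ h (λ x x∈G → trans (cong (c ⁻¹ *_) (g≡ch x x∈G)) (⁻¹-cancelˡ (h x) c≢0)) (scale∈ (c ⁻¹) g g∈W)

    sumBelow∈ : ∀ n {g : ℕ → Fun} → (∀ j → j < n → W (g j)) → W (λ x → sumBelow n (λ j → g j x))
    sumBelow∈ zero    _  = zero∈
    sumBelow∈ (suc n) g∈ = add∈ _ _ (sumBelow∈ n (λ j j<n → g∈ j (ℕ.m<n⇒m<1+n j<n))) (g∈ n (ℕ.n<1+n n))

    translationCoeff∈ : ∀ c → W (combination c) → ∀ {m} → m < q → W (translationCoeff c m)
    translationCoeff∈ c combination∈W =
      applyUpTo⁻ (translationCoeff c) q (coefficients∈ W-subspace _ Fq Fq-unique |coeffs|≤|Fq| values∈)
      where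
      |coeffs|≤|Fq| : length (applyUpTo (translationCoeff c) q) ≤ length Fq
      |coeffs|≤|Fq| = ℕ.≤-reflexive (trans (length-applyUpTo (translationCoeff c) q) (sym |Fq|≡q))
      values∈ : ∀ t → t ∈ Fq → W (eval (applyUpTo (translationCoeff c) q) t)
      values∈ t t∈Fq = resp _ _ (λ x x∈G → trans (act-translation c tᵠ x∈G) (sym (eval-applyUpTo q _ t x)))
                              (act∈ _ _ (translation∈G tᵠ) combination∈W)
        where
        tᵠ : InFq t
        tᵠ = Fq⊆𝔽q t t∈Fq

    f∈-≼ : ∀ {k} → k < q → W (f k) → ∀ {j} → j ≼ k → W (f j)
    f∈-≼ {k} k<q fₖ∈W {j} j≼k =
      unscale∈ (choose k m) (choose-≼ k<q (∸-≼ j≼k)) (translationCoeff∈ (δ k) δₖ∈W m<q) coeff≡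
      where
      m = k ∸ j
      m<q : m < q
      m<q = ℕ.≤-<-trans (ℕ.m∸n≤m k j) k<q
      δₖ∈W : W (combination (δ k))
      δₖ∈W = resp _ _ (λ x _ → sym (combination-δ k<q x)) fₖ∈W
      coeff≡ : ∀ x → InG x → translationCoeff (δ k) m x ≡ choose k m * f j x
      coeff≡ x _ = begin
        sumBelow q (λ i → (δ k i * choose i m) * f (i ∸ m) x)  ≡⟨ sumBelow-cong q (λ i _ → *-assoc _ _ _) ⟩
        sumBelow q (λ i → δ k i * (choose i m * f (i ∸ m) x))  ≡⟨ sumBelow-δ (λ i → choose i m * f (i ∸ m) x) k<q ⟩
        choose k m * f (k ∸ m) x                               ≡⟨ cong (λ i → choose k m * f i x) (ℕ.m∸[m∸n]≡n (≼⇒≤ j≼k)) ⟩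
        choose k m * f j x                                     ∎

    span⊆ : ∀ {k} → k < q → W (f k) → ∀ {h} → SpanPrec Fq χ v k h → W h
    span⊆ {k} k<q fₖ∈W (c , c-supp , h≈c) = resp _ _ (λ x x∈G → sym (h≈c x x∈G)) (sumBelow∈ q term∈)
      where
      term∈ : ∀ j → j < q → W (λ x → c j * f j x)
      term∈ j _ with j ≼? k
      ... | yes j≼k = scale∈ (c j) (f j) (f∈-≼ k<q fₖ∈W j≼k)
      ... | no  j⋠k = resp _ _ (λ x _ → sym (trans (cong (_* f j x) (c-supp j (j⋠k ∘ Preceq⇒≼))) (zeroˡ _))) zero∈

    leading-f₀∈ : ∀ c → W (combination c) → ∀ {J} → J < q → c J ≢ 0# → (∀ j → J < j → j < q → c j ≡ 0#) →
                  W (f 0)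
    leading-f₀∈ c c∈W {J} J<q c_J≢0 above≡0 = unscale∈ (c J) c_J≢0 (translationCoeff∈ c c∈W J<q) leading≡
      where
      leading≡ : ∀ x → InG x → translationCoeff c J x ≡ c J * f 0 x
      leading≡ x _ = begin
        sumBelow q (λ j → (c j * choose j J) * f (j ∸ J) x)  ≡⟨ sumBelow-single q J J<q others≡0 ⟩
        (c J * choose J J) * f (J ∸ J) x                     ≡⟨ cong₂ (λ e i → (c J * e) * f i x) (choose-diag J) (ℕ.n∸n≡0 J) ⟩
        (c J * 1#) * f 0 x                                   ≡⟨ cong (_* f 0 x) (*-identityʳ (c J)) ⟩
        c J * f 0 x                                          ∎
        where
        others≡0 : ∀ j → j < q → j ≢ J → (c j * choose j J) * f (j ∸ J) x ≡ 0#
        others≡0 j j<q j≢J with ℕ.<-cmp j J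
        ... | tri< j<J _ _ = trans (cong (λ e → (c j * e) * f (j ∸ J) x) (choose-⋠ (ℕ.<⇒≱ j<J ∘ ≼⇒≤)))
                                   (trans (cong (_* f (j ∸ J) x) (zeroʳ (c j))) (zeroˡ _))
        ... | tri≈ _ j≡J _ = ⊥-elim (j≢J j≡J)
        ... | tri> _ _ J<j = trans (cong (λ z → (z * choose j J) * f (j ∸ J) x) (above≡0 j J<j j<q))
                                   (trans (cong (_* f (j ∸ J) x) (zeroˡ (choose j J))) (zeroˡ _))

    f₀∈ : ∀ {g} → W g → NonZeroF g → W (f 0)
    f₀∈ {g} g∈W (x₀ , x₀∈G , gx₀≢0) =
      [ ⊥-elim ∘ c≢0 , (λ (J , J<q , c_J≢0 , above≡0) → leading-f₀∈ c c∈W J<q c_J≢0 above≡0) ]′ (lastNonZero q c)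
      where
      c : ℕ → Carrier
      c = proj₁ (spanning (⊆Ind g g∈W))
      g≈c : g ≈G combination c
      g≈c = proj₂ (spanning (⊆Ind g g∈W))
      c∈W : W (combination c)
      c∈W = resp _ _ g≈c g∈W
      c≢0 : ¬ (∀ j → j < q → c j ≡ 0#)
      c≢0 c≡0 = gx₀≢0 (trans (g≈c x₀ x₀∈G) (sumBelow-zero q (λ j j<q → trans (cong (_* f j x₀) (c≡0 j j<q)) (zeroˡ _))))

  generated⇔span : ∀ {k} → k < q → ∀ h →
                   (Generated χ (f k) h → SpanPrec Fq χ v k h) × (SpanPrec Fq χ v k h → Generated χ (f k) h)
  generated⇔span k<q h = (λ h∈⟨fₖ⟩ → h∈⟨fₖ⟩ _ (span-isSubrep k<q) (f∈span k<q))
                       , (λ h∈span W W-subrep fₖ∈W → span⊆ W-subrep k<q fₖ∈W h∈span)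

  f₀-right : ∀ {g x} → InG g → InG x → f 0 (mul x g) ≡ χ (proj₁ g , 0#) * f 0 x
  f₀-right {g} {x} g∈G x∈G = begin
    f 0 (mul x g)                    ≡⟨ f-right 0 x∈G g∈G ⟩
    χ (proj₁ g , 0#) * (1# * ψ x)    ≡⟨ cong (χ (proj₁ g , 0#) *_) (sym (fkv-closed-form 0 x∈G)) ⟩
    χ (proj₁ g , 0#) * f 0 x         ∎

  f₀≢0 : NonZeroF (f 0)
  f₀≢0 = (1# , 0#) , InG-1 , λ f₀≡0 → v≢0 (begin
    v                     ≡⟨ sym (*-identityˡ v) ⟩
    1# * v                ≡⟨ cong (_* v) (sym χ-1) ⟩
    ψ (1# , 0#)           ≡⟨ sym (*-identityˡ _) ⟩
    1# * ψ (1# , 0#)      ≡⟨ sym (fkv-closed-form 0 InG-1) ⟩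
    f 0 (1# , 0#)         ≡⟨ f₀≡0 ⟩
    0#                    ∎)

  line-isSubrep : IsSubrep χ (SpanOne (f 0))
  line-isSubrep = record
    { ⊆Ind   = λ { h (c , h≈cf₀) → ≈G-isInd h≈cf₀ λ h′ x h′∈H x∈G →
                 trans (cong (c *_) (f-isInd 0 h′ x h′∈H x∈G)) (x∙yz≈y∙xz c (χ h′) (f 0 x)) }
    ; resp   = λ { h h′ h≈h′ (c , h≈cf₀) → c , λ x x∈G → trans (sym (h≈h′ x x∈G)) (h≈cf₀ x x∈G) }
    ; zero∈  = 0# , λ x _ → sym (zeroˡ (f 0 x))
    ; add∈   = λ { h h′ (c , h≈cf₀) (c′ , h′≈c′f₀) → c + c′ , λ x x∈G →
                 trans (cong₂ _+_ (h≈cf₀ x x∈G) (h′≈c′f₀ x x∈G)) (sym (distribʳ _ _ _)) }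
    ; scale∈ = λ { a h (c , h≈cf₀) → a * c , λ x x∈G → trans (cong (a *_) (h≈cf₀ x x∈G)) (sym (*-assoc _ _ _)) }
    ; act∈   = λ { g h g∈G (c , h≈cf₀) → c * χ (proj₁ g , 0#) , λ x x∈G →
                 trans (h≈cf₀ (mul x g) (InG-mul x∈G g∈G))
                       (trans (cong (c *_) (f₀-right g∈G x∈G)) (sym (*-assoc _ _ _))) }
    }

  f₀∈line : SpanOne (f 0) (f 0)
  f₀∈line = 1# , λ x _ → sym (*-identityˡ (f 0 x))

  line⊆ : ∀ {W} → IsSubrep χ W → W (f 0) → ∀ {h} → SpanOne (f 0) h → W h
  line⊆ W-subrep f₀∈W (c , h≈cf₀) =
    IsSubrep.resp W-subrep _ _ (λ x x∈G → sym (h≈cf₀ x x∈G)) (IsSubrep.scale∈ W-subrep c (f 0) f₀∈W)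

  line-irreducible : IsIrreducible χ (SpanOne (f 0))
  line-irreducible = line-isSubrep , (f 0 , f₀∈line , f₀≢0) ,
    λ { W W-subrep _ (g , g∈W , g≢0) _ → line⊆ W-subrep (f₀∈ W-subrep g∈W g≢0) }

  irreducible⊆line : ∀ {W} → IsIrreducible χ W → ∀ {g} → W g → SpanOne (f 0) g
  irreducible⊆line {W} (W-subrep , (g , g∈W , g≢0) , minimal) =
    minimal (SpanOne (f 0)) line-isSubrep (λ _ → line⊆ W-subrep (f₀∈ W-subrep g∈W g≢0)) (f 0 , f₀∈line , f₀≢0) _

  socle⇔line : ∀ h → (InSocle χ h → SpanOne (f 0) h) × (SpanOne (f 0) h → InSocle χ h)
  socle⇔line h =
    (λ { (gs , gs-irreducible , h≈Σgs) →
         IsSubrep.resp line-isSubrep _ h (λ x x∈G → sym (h≈Σgs x x∈G)) (sum∈line gs-irreducible) }) ,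
    (λ h∈line → h ∷ [] , (SpanOne (f 0) , line-irreducible , h∈line) ∷ [] , λ x _ → sym (+-identityʳ (h x)))
    where
    sum∈line : ∀ {gs} → All (λ g → Σ (Fun → Set) λ W → IsIrreducible χ W × W g) gs → SpanOne (f 0) (sumFuns gs)
    sum∈line []                                 = IsSubrep.zero∈ line-isSubrep
    sum∈line ((W , W-irreducible , g∈W) ∷ gs∈) =
      IsSubrep.add∈ line-isSubrep _ _ (irreducible⊆line W-irreducible g∈W) (sum∈line gs∈)

proposition2p7 :
    (p : ℕ) → Prime p → 5 ≤ p →
    (F : Field) →
    let open Rep F p in
    natF p ≡ 0# →
    (Σ (List Carrier) λ all → ∀ x → x ∈ all) →
    (Fq : List Carrier) → Unique Fq → length Fq ≡ q →
    (∀ x → x ∈ Fq → InFq x) → (∀ x → InFq x → x ∈ Fq) →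
    (χ : Pt → Carrier) → IsCharacter χ →
    (v : Carrier) → ¬ v ≡ 0# →
    ((k : ℕ) → k < q → ∀ h →
       (Generated χ (fkv Fq χ k v) h → SpanPrec Fq χ v k h) ×
       (SpanPrec Fq χ v k h → Generated χ (fkv Fq χ k v) h)) ×
    (∀ h → (InSocle χ h → SpanOne (fkv Fq χ 0 v) h) ×
           (SpanOne (fkv Fq χ 0 v) h → InSocle χ h))
proposition2p7 p p-prime _ F char-p _ Fq Fq-unique |Fq|≡q Fq⊆𝔽q 𝔽q⊆Fq χ χ-character v v≢0 =
  (λ k k<q → generated⇔span k<q) , socle⇔line
  where
  open InducedRepresentation F p p-prime char-p Fq Fq-unique |Fq|≡q Fq⊆𝔽q 𝔽q⊆Fq χ χ-character v v≢0
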